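{- Let $a_{n,0}$ denote the number of matchings of size $n$ with no occurrence of the endhered pattern $21$. Then $a_{1,0}=1$, $a_{2,0}=2$, and for all $n\ge 2$, $$a_{n+1,0}=2n\,a_{n,0}+2(n-1)\,a_{n-1,0}.$$
   Context: A (perfect) matching of size $n$ is a partition of $\{1,\dots,2n\}$ into $n$ two-element sets called arcs. An occurrence of the endhered pattern $21$ in a matching $\mu$ of size $n$ is a pair of integers $(i,j)$ with $i\ge0$, $i+2\le j$, $j+2\le 2n$, such that $\{i+1,j+2\}$ and $\{i+2,j+1\}$ are both arcs of $\mu$. -}

module Defs where

open import Data.Nat using (ℕ; zero; suc; _+_; _*_; _≤_)
open import Data.Nat.Properties using (_≤?_)
open import Data.Fin using (Fin; toℕ)
open import Data.Fin.Properties using (any?; all?) renaming (_≟_ to _≟ᶠ_)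
open import Data.Vec using (Vec; []; _∷_; lookup)
open import Data.List using (List; []; _∷_; concatMap; map; filter; length; allFin)
open import Data.Product using (Σ; ∃; _×_; _,_)
open import Relation.Nullary using (¬_; Dec; yes; no; ¬?; _×-dec_)
open import Relation.Binary.PropositionalEquality using (_≡_)
import Data.Nat as ℕ

allVecs : (k m : ℕ) → List (Vec (Fin m) k)
allVecs zero    m = [] ∷ []
allVecs (suc k) m = concatMap (λ x → map (x ∷_) (allVecs k m)) (allFin m)

-- A perfect matching on a 2n-element set {0,…,2n-1} (0-based positions) is
-- encoded as its partner function: a fixed-point-free involution.
-- The arcs are the sets {p , partner p}.
IsMatching : {m : ℕ} → Vec (Fin m) m → Set
IsMatching {m} v = (p : Fin m) → (¬ (lookup v p ≡ p)) × (lookup v (lookup v p) ≡ p)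

isMatching? : {m : ℕ} (v : Vec (Fin m) m) → Dec (IsMatching v)
isMatching? v = all? (λ p → ¬? (lookup v p ≟ᶠ p) ×-dec (lookup v (lookup v p) ≟ᶠ p))

Arc : {m : ℕ} → Vec (Fin m) m → ℕ → ℕ → Set
Arc {m} v x y = Σ (Fin m) λ p → (toℕ p ≡ x) × (toℕ (lookup v p) ≡ y)

arc? : {m : ℕ} (v : Vec (Fin m) m) (x y : ℕ) → Dec (Arc v x y)
arc? v x y = any? (λ p → (toℕ p ℕ.≟ x) ×-dec (toℕ (lookup v p) ℕ.≟ y))

-- Occurrence of the endhered pattern 21 in a matching of size n (m = 2n):
-- a pair (i , j) with 0 ≤ i, i + 2 ≤ j, j + 2 ≤ 2n such that {i+1, j+2} and
-- {i+2, j+1} (1-based) are arcs.  In 0-based positions these are the arcs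
-- {i, j+1} and {i+1, j}.  Since j + 2 ≤ m, both i and j are < m, so they
-- range over Fin m.
Occ21 : {m : ℕ} → Vec (Fin m) m → Set
Occ21 {m} v = Σ (Fin m) λ i → Σ (Fin m) λ j →
  (toℕ i + 2 ≤ toℕ j) × (toℕ j + 2 ≤ m) ×
  Arc v (toℕ i) (toℕ j + 1) × Arc v (toℕ i + 1) (toℕ j)

occ21? : {m : ℕ} (v : Vec (Fin m) m) → Dec (Occ21 v)
occ21? {m} v = any? λ i → any? λ j →
  (toℕ i + 2 ≤? toℕ j) ×-dec (toℕ j + 2 ≤? m) ×-dec
  arc? v (toℕ i) (toℕ j + 1) ×-dec arc? v (toℕ i + 1) (toℕ j)

Avoids21 : {m : ℕ} → Vec (Fin m) m → Set
Avoids21 v = IsMatching v × ¬ Occ21 v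

avoids21? : {m : ℕ} (v : Vec (Fin m) m) → Dec (Avoids21 v)
avoids21? v = isMatching? v ×-dec ¬? (occ21? v)

a0 : ℕ → ℕ
a0 n = length (filter avoids21? (allVecs (2 * n) (2 * n)))

-- Removing the arc at the last point of an avoiding matching w of size n + 1 leaves a matching v
-- of size n, and w is determined by v and the partner p of its last point. If v avoids the
-- pattern, w does exactly when p, one of 2n + 1 positions, is not the partner of the last point
-- of v: 2n choices for each v. If v contains the pattern, the last arc of w separates the two nested
-- arcs of every occurrence in v, so all occurrences share an end and there is only one. Merging
-- its two arcs gives an avoiding matching of size n − 1, and the side on which the last arc
-- separates them is encoded by an endpoint of the merged arc: 2n − 2 choices.

module Submission where

open import Data.Nat using (ℕ; zero; suc; pred; _+_; _*_; _∸_; _≤_; _<_; _≟_; _<?_; z≤n; s≤s)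
open import Data.Nat.Properties
open import Data.List
  using (List; []; _∷_; length; map; concatMap; filter; _++_; upTo; allFin; cartesianProduct; cartesianProductWith)
open import Data.List.Properties using (length-map; length-++; length-upTo)
open import Data.List.Membership.Propositional using (_∈_)
open import Data.List.Membership.Propositional.Properties
open import Data.List.Relation.Unary.Any using (here; there)
import Data.List.Relation.Unary.All as All
open import Data.List.Relation.Unary.Unique.Propositional using (Unique)
open import Data.List.Relation.Unary.Unique.Propositional.Properties
  using (cartesianProductWith⁺; cartesianProduct⁺; allFin⁺; filter⁺; upTo⁺)
open import Data.List.Relation.Unary.AllPairs using ([]; _∷_)
open import Data.Product using (Σ; _×_; _,_; proj₁; proj₂)
open import Data.Sum using (_⊎_; inj₁; inj₂; [_,_]′)
open import Data.Empty using (⊥-elim)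
open import Relation.Nullary using (¬_; Dec; yes; no; ¬?)
open import Relation.Unary using (Pred; Decidable)
open import Relation.Binary.PropositionalEquality
open import Relation.Binary.Definitions using (tri<; tri≈; tri>)
open import Level using (0ℓ)
open import Defs
open import Data.Fin using (Fin; toℕ; fromℕ<)
open import Data.Fin.Properties using (toℕ-injective; toℕ<n; fromℕ<-toℕ; toℕ-fromℕ<)
open import Data.Vec using (Vec; []; _∷_; lookup; tabulate)
open import Data.Vec.Properties using (lookup∘tabulate; tabulate∘lookup; tabulate-cong; ∷-injective)
open import Function using (_∘_)

-- Counting lists without repetition

module _ {A : Set} where

  removeMember : {x : A} (xs : List A) → x ∈ xs → List A
  removeMember (_ ∷ ys) (here _)  = ys
  removeMember (y ∷ ys) (there p) = y ∷ removeMember ys p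

  length-removeMember : {x : A} (xs : List A) (p : x ∈ xs) →
                        length xs ≡ suc (length (removeMember xs p))
  length-removeMember (_ ∷ ys) (here _)  = refl
  length-removeMember (_ ∷ ys) (there p) = cong suc (length-removeMember ys p)

  ∈-removeMember : {x y : A} (xs : List A) (p : x ∈ xs) →
                   y ∈ xs → y ≢ x → y ∈ removeMember xs p
  ∈-removeMember (_ ∷ _)  (here e)  (here e′) y≢x = ⊥-elim (y≢x (trans e′ (sym e)))
  ∈-removeMember (_ ∷ _)  (here _)  (there q) _   = q
  ∈-removeMember (_ ∷ _)  (there _) (here e′) _   = here e′
  ∈-removeMember (_ ∷ zs) (there p) (there q) y≢x = there (∈-removeMember zs p q y≢x)

length-≤-injection : {A B : Set} (f : A → B) (xs : List A) (ys : List B) → Unique xs →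
  (∀ {a} → a ∈ xs → f a ∈ ys) →
  (∀ {a a′} → a ∈ xs → a′ ∈ xs → f a ≡ f a′ → a ≡ a′) →
  length xs ≤ length ys
length-≤-injection f [] ys _ _ _ = z≤n
length-≤-injection f (x ∷ xs) ys (x∉xs ∷ xs!) maps inj =
  subst (suc (length xs) ≤_) (sym (length-removeMember ys fx∈ys)) (s≤s rest)
  where
  fx∈ys = maps (here refl)
  rest : length xs ≤ length (removeMember ys fx∈ys)
  rest = length-≤-injection f xs (removeMember ys fx∈ys) xs!
    (λ a∈ → ∈-removeMember ys fx∈ys (maps (there a∈))
              (λ e → All.lookup x∉xs a∈ (inj (here refl) (there a∈) (sym e))))
    (λ a∈ a′∈ → inj (there a∈) (there a′∈))

length-≡-bijection : {A B : Set} (xs : List A) (ys : List B) → Unique xs → Unique ys →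
  (f : A → B) (g : B → A) →
  (∀ {a} → a ∈ xs → f a ∈ ys) → (∀ {b} → b ∈ ys → g b ∈ xs) →
  (∀ {a} → a ∈ xs → g (f a) ≡ a) → (∀ {b} → b ∈ ys → f (g b) ≡ b) →
  length xs ≡ length ys
length-≡-bijection xs ys xs! ys! f g maps-f maps-g gf fg = ≤-antisym
  (length-≤-injection f xs ys xs! maps-f
    (λ a∈ a′∈ e → trans (sym (gf a∈)) (trans (cong g e) (gf a′∈))))
  (length-≤-injection g ys xs ys! maps-g
    (λ b∈ b′∈ e → trans (sym (fg b∈)) (trans (cong f e) (fg b′∈))))

length-cartesianProduct : {A B : Set} (xs : List A) (ys : List B) →
                          length (cartesianProduct xs ys) ≡ length xs * length ys
length-cartesianProduct []       ys = refl
length-cartesianProduct (x ∷ xs) ys = begin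
  length (map (x ,_) ys ++ cartesianProduct xs ys)        ≡⟨ length-++ (map (x ,_) ys) ⟩
  length (map (x ,_) ys) + length (cartesianProduct xs ys) ≡⟨ cong₂ _+_ (length-map (x ,_) ys)
                                                                     (length-cartesianProduct xs ys) ⟩
  length ys + length xs * length ys                       ∎
  where open ≡-Reasoning

length-filter-split : {A : Set} {P : Pred A 0ℓ} (P? : Decidable P) (xs : List A) →
  length xs ≡ length (filter P? xs) + length (filter (λ x → ¬? (P? x)) xs)
length-filter-split P? [] = refl
length-filter-split P? (x ∷ xs) with P? x
... | yes _ = cong suc (length-filter-split P? xs)
... | no _  = trans (cong suc (length-filter-split P? xs)) (sym (+-suc _ _))

-- Data.Fin's punchIn and punchOut on ℕ; punchOut p p = p is a junk value.

punchIn : ℕ → ℕ → ℕ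
punchIn zero    x       = suc x
punchIn (suc p) zero    = zero
punchIn (suc p) (suc x) = suc (punchIn p x)

punchOut : ℕ → ℕ → ℕ
punchOut zero    zero    = zero
punchOut zero    (suc x) = x
punchOut (suc p) zero    = zero
punchOut (suc p) (suc x) = suc (punchOut p x)

punchIn-< : ∀ {p x} → x < p → punchIn p x ≡ x
punchIn-< {suc p} {zero}  _       = refl
punchIn-< {suc p} {suc x} (s≤s h) = cong suc (punchIn-< h)

punchIn-≥ : ∀ {p x} → p ≤ x → punchIn p x ≡ suc x
punchIn-≥ {zero}          _       = refl
punchIn-≥ {suc p} {suc x} (s≤s h) = cong suc (punchIn-≥ h)

punchIn-pred : ∀ {p n} → p < n → punchIn p (pred n) ≡ n
punchIn-pred {n = suc n} (s≤s h) = punchIn-≥ h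

punchIn-≢ : ∀ p x → punchIn p x ≢ p
punchIn-≢ zero    x       ()
punchIn-≢ (suc p) zero    ()
punchIn-≢ (suc p) (suc x) e = punchIn-≢ p x (suc-injective e)

punchIn-≤ : ∀ p x → punchIn p x ≤ suc x
punchIn-≤ zero    x       = ≤-refl
punchIn-≤ (suc p) zero    = z≤n
punchIn-≤ (suc p) (suc x) = s≤s (punchIn-≤ p x)

punchIn-mono-< : ∀ p {x y} → x < y → punchIn p x < punchIn p y
punchIn-mono-< zero    h                       = s≤s h
punchIn-mono-< (suc p) {zero}  {suc y} _       = s≤s z≤n
punchIn-mono-< (suc p) {suc x} {suc y} (s≤s h) = s≤s (punchIn-mono-< p h)

punchIn-suc : ∀ p x → suc (punchIn p x) ≢ p → punchIn p (suc x) ≡ suc (punchIn p x)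
punchIn-suc zero          x       _  = refl
punchIn-suc (suc zero)    zero    ne = ⊥-elim (ne refl)
punchIn-suc (suc (suc p)) zero    _  = refl
punchIn-suc (suc p)       (suc x) ne = cong suc (punchIn-suc p x (ne ∘ cong suc))

punchOut-punchIn : ∀ p x → punchOut p (punchIn p x) ≡ x
punchOut-punchIn zero    x       = refl
punchOut-punchIn (suc p) zero    = refl
punchOut-punchIn (suc p) (suc x) = cong suc (punchOut-punchIn p x)

punchIn-punchOut : ∀ {p x} → x ≢ p → punchIn p (punchOut p x) ≡ x
punchIn-punchOut {zero}  {zero}  ne = ⊥-elim (ne refl)
punchIn-punchOut {zero}  {suc x} _  = refl
punchIn-punchOut {suc p} {zero}  _  = refl
punchIn-punchOut {suc p} {suc x} ne = cong suc (punchIn-punchOut (ne ∘ cong suc))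

punchOut-≤ : ∀ {p x} → x ≤ p → punchOut p x ≡ x
punchOut-≤ {zero}  {zero}  _       = refl
punchOut-≤ {suc p} {zero}  _       = refl
punchOut-≤ {suc p} {suc x} (s≤s h) = cong suc (punchOut-≤ h)

punchOut-> : ∀ {p x} → p < x → suc (punchOut p x) ≡ x
punchOut-> {zero}  {suc x} _       = refl
punchOut-> {suc p} {suc x} (s≤s h) = cong suc (punchOut-> h)

punchOut-suc-self : ∀ p → punchOut p (suc p) ≡ p
punchOut-suc-self p = suc-injective (punchOut-> (n<1+n p))

punchOut-suc : ∀ p x → x ≢ p → punchOut p (suc x) ≡ suc (punchOut p x)
punchOut-suc zero          zero    ne = ⊥-elim (ne refl)
punchOut-suc zero          (suc x) _  = refl
punchOut-suc (suc zero)    zero    _  = refl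
punchOut-suc (suc (suc p)) zero    _  = refl
punchOut-suc (suc p)       (suc x) ne = cong suc (punchOut-suc p x (ne ∘ cong suc))

punchOut-mono-≤ : ∀ p {x y} → x ≤ y → punchOut p x ≤ punchOut p y
punchOut-mono-≤ zero    {zero}          _       = z≤n
punchOut-mono-≤ zero    {suc x} {suc y} (s≤s h) = h
punchOut-mono-≤ (suc p) {zero}          _       = z≤n
punchOut-mono-≤ (suc p) {suc x} {suc y} (s≤s h) = s≤s (punchOut-mono-≤ p h)

punchOut-< : ∀ {p x k} → p < suc k → x < suc k → x ≢ p → punchOut p x < k
punchOut-< {p} {x} {k} p≤k x≤k x≢p with <-cmp x p
... | tri< x<p _ _ = subst (_< k) (sym (punchOut-≤ (<⇒≤ x<p))) (<-≤-trans x<p (≤-pred p≤k))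
... | tri≈ _ x≡p _ = ⊥-elim (x≢p x≡p)
... | tri> _ _ p<x = subst (_≤ k) (sym (punchOut-> p<x)) (≤-pred x≤k)

suc-punchOut-≢ : ∀ {p x} → x ≢ p → suc x ≢ p → suc (punchOut p x) ≢ p
suc-punchOut-≢ {p} {x} x≢p x+1≢p with x <? p
... | yes x<p = subst (λ z → suc z ≢ p) (sym (punchOut-≤ (<⇒≤ x<p))) x+1≢p
... | no x≮p  = subst (_≢ p) (sym (punchOut-> (≤∧≢⇒< (≮⇒≥ x≮p) (x≢p ∘ sym)))) x≢p

-- Matchings as partner functions on ℕ, and inserting or removing one arc

-- f is the partner function of a perfect matching of {0, …, k-1};
-- its values outside that range are irrelevant.
record Matching (k : ℕ) (f : ℕ → ℕ) : Set where
  field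
    partner-<  : ∀ {x} → x < k → f x < k
    partner-≢  : ∀ {x} → x < k → f x ≢ x
    involutive : ∀ {x} → x < k → f (f x) ≡ x

open Matching

matching-cong : ∀ {k f g} → (∀ x → x < k → f x ≡ g x) → Matching k f → Matching k g
matching-cong {k} {f} {g} f≗g M = record
  { partner-<  = λ h → subst (_< k) (f≗g _ h) (partner-< M h)
  ; partner-≢  = λ h e → partner-≢ M h (trans (f≗g _ h) e)
  ; involutive = λ {x} h → begin
      g (g x) ≡⟨ cong g (sym (f≗g x h)) ⟩
      g (f x) ≡⟨ sym (f≗g (f x) (partner-< M h)) ⟩
      f (f x) ≡⟨ involutive M h ⟩
      x       ∎
  }
  where open ≡-Reasoning

-- For a < b, punchIn₂ a b enumerates ℕ ∖ {a, b} increasingly.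
punchIn₂ : ℕ → ℕ → ℕ → ℕ
punchIn₂ a b y = punchIn b (punchIn a y)

punchOut₂ : ℕ → ℕ → ℕ → ℕ
punchOut₂ a b x = punchOut a (punchOut b x)

punchIn₂-< : ∀ a b {y k} → y < k → punchIn₂ a b y < suc (suc k)
punchIn₂-< a b {y} h = ≤-trans (s≤s (≤-trans (punchIn-≤ b _) (s≤s (punchIn-≤ a y)))) (s≤s (s≤s h))

punchIn₂-mono-< : ∀ a b {x y} → x < y → punchIn₂ a b x < punchIn₂ a b y
punchIn₂-mono-< a b h = punchIn-mono-< b (punchIn-mono-< a h)

punchOut₂-mono-≤ : ∀ a b {x y} → x ≤ y → punchOut₂ a b x ≤ punchOut₂ a b y
punchOut₂-mono-≤ a b h = punchOut-mono-≤ a (punchOut-mono-≤ b h)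

punchOut₂-punchIn₂ : ∀ a b y → punchOut₂ a b (punchIn₂ a b y) ≡ y
punchOut₂-punchIn₂ a b y = trans (cong (punchOut a) (punchOut-punchIn b _)) (punchOut-punchIn a y)

-- Two new points a < b are inserted, matched to each other, and the old points are renumbered.
insertArc : ℕ → ℕ → (ℕ → ℕ) → ℕ → ℕ
insertArc a b f x with x ≟ a
... | yes _ = b
... | no _ with x ≟ b
...   | yes _ = a
...   | no _  = punchIn₂ a b (f (punchOut₂ a b x))

removeArc : ℕ → ℕ → (ℕ → ℕ) → ℕ → ℕ
removeArc a b g x = punchOut₂ a b (g (punchIn₂ a b x))

insertArc-a : ∀ a b f → insertArc a b f a ≡ b
insertArc-a a b f with a ≟ a
... | yes _ = refl
... | no a≢a = ⊥-elim (a≢a refl)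

insertArc-b : ∀ {a b} f → a ≢ b → insertArc a b f b ≡ a
insertArc-b {a} {b} f a≢b with b ≟ a
... | yes b≡a = ⊥-elim (a≢b (sym b≡a))
... | no _ with b ≟ b
...   | yes _ = refl
...   | no b≢b = ⊥-elim (b≢b refl)

insertArc-other : ∀ {a b x} f → x ≢ a → x ≢ b →
                  insertArc a b f x ≡ punchIn₂ a b (f (punchOut₂ a b x))
insertArc-other {a} {b} {x} f x≢a x≢b with x ≟ a
... | yes x≡a = ⊥-elim (x≢a x≡a)
... | no _ with x ≟ b
...   | yes x≡b = ⊥-elim (x≢b x≡b)
...   | no _    = refl

by-cases-on-arc : ∀ {a b} (P : ℕ → Set) → P a → P b → (∀ x → x ≢ a → x ≢ b → P x) →
                  ∀ x → P x
by-cases-on-arc {a} {b} P pa pb other x with x ≟ a | x ≟ b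
... | yes refl | _        = pa
... | no _     | yes refl = pb
... | no x≢a   | no x≢b   = other x x≢a x≢b

module _ {a b : ℕ} (a<b : a < b) where

  a≢b : a ≢ b
  a≢b = <⇒≢ a<b

  punchIn₂-≢-b : ∀ y → punchIn₂ a b y ≢ b
  punchIn₂-≢-b y = punchIn-≢ b (punchIn a y)

  punchIn₂-≢-a : ∀ y → punchIn₂ a b y ≢ a
  punchIn₂-≢-a y e with punchIn a y <? b
  ... | yes lt = punchIn-≢ a y (trans (sym (punchIn-< lt)) e)
  ... | no ge  = <-irrefl refl (<-≤-trans a<b (≤-trans (≮⇒≥ ge)
                   (≤-trans (n≤1+n _) (≤-reflexive (trans (sym (punchIn-≥ (≮⇒≥ ge))) e)))))

  punchOut-≢-a : ∀ {x} → x ≢ a → punchOut b x ≢ a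
  punchOut-≢-a {x} x≢a e with x ≤? b
  ... | yes x≤b = x≢a (trans (sym (punchOut-≤ x≤b)) e)
  ... | no x≰b  = <-irrefl refl (<-≤-trans a<b (≤-pred
                    (subst (b <_) (trans (sym (punchOut-> (≰⇒> x≰b))) (cong suc e)) (≰⇒> x≰b))))

  punchIn₂-punchOut₂ : ∀ {x} → x ≢ a → x ≢ b → punchIn₂ a b (punchOut₂ a b x) ≡ x
  punchIn₂-punchOut₂ x≢a x≢b =
    trans (cong (punchIn b) (punchIn-punchOut (punchOut-≢-a x≢a))) (punchIn-punchOut x≢b)

  punchOut₂-< : ∀ {k x} → b < suc (suc k) → x < suc (suc k) → x ≢ a → x ≢ b → punchOut₂ a b x < k
  punchOut₂-< b<k+2 x<k+2 x≢a x≢b =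
    punchOut-< (<-≤-trans a<b (≤-pred b<k+2)) (punchOut-< b<k+2 x<k+2 x≢b) (punchOut-≢-a x≢a)

  punchIn₂-suc : ∀ y → suc (punchIn₂ a b y) ≢ a → suc (punchIn₂ a b y) ≢ b →
                 punchIn₂ a b (suc y) ≡ suc (punchIn₂ a b y)
  punchIn₂-suc y ≢a ≢b = trans (cong (punchIn b) (punchIn-suc a y ≢a′)) (punchIn-suc b (punchIn a y) ≢b)
    where
    ≢a′ : suc (punchIn a y) ≢ a
    ≢a′ e = ≢a (trans (cong suc (punchIn-< (<-trans (≤-reflexive e) a<b))) e)

  punchOut₂-suc : ∀ x → x ≢ a → x ≢ b → punchOut₂ a b (suc x) ≡ suc (punchOut₂ a b x)
  punchOut₂-suc x x≢a x≢b =
    trans (cong (punchOut a) (punchOut-suc b x x≢b)) (punchOut-suc a (punchOut b x) (punchOut-≢-a x≢a))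

  insertArc-≡-a : ∀ f x → insertArc a b f x ≡ a → x ≡ b
  insertArc-≡-a f x e with x ≟ a
  ... | yes _ = ⊥-elim (<-irrefl (sym e) a<b)
  ... | no _ with x ≟ b
  ...   | yes x≡b = x≡b
  ...   | no _    = ⊥-elim (punchIn₂-≢-a _ e)

  insertArc-≡-b : ∀ f x → insertArc a b f x ≡ b → x ≡ a
  insertArc-≡-b f x e with x ≟ a
  ... | yes x≡a = x≡a
  ... | no _ with x ≟ b
  ...   | yes _ = ⊥-elim (<-irrefl e a<b)
  ...   | no _  = ⊥-elim (punchIn₂-≢-b _ e)

  insertArc-matching : ∀ {k f} → b < suc (suc k) → Matching k f → Matching (suc (suc k)) (insertArc a b f)
  insertArc-matching {k} {f} b<k+2 M = record
    { partner-<  = λ {x} → by-cases-on-arc (λ x → x < suc (suc k) → g x < suc (suc k))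
        (λ _ → subst (_< suc (suc k)) (sym (insertArc-a a b f)) b<k+2)
        (λ _ → subst (_< suc (suc k)) (sym (insertArc-b f a≢b)) (<-trans a<b b<k+2))
        (λ x x≢a x≢b h → subst (_< suc (suc k)) (sym (insertArc-other f x≢a x≢b))
                           (punchIn₂-< a b (partner-< M (y< h x≢a x≢b))))
        x
    ; partner-≢  = λ {x} → by-cases-on-arc (λ x → x < suc (suc k) → g x ≢ x)
        (λ _ e → a≢b (trans (sym e) (insertArc-a a b f)) )
        (λ _ e → a≢b (trans (sym (insertArc-b f a≢b)) e))
        (λ x x≢a x≢b h e → partner-≢ M (y< h x≢a x≢b)
           (trans (sym (punchOut₂-punchIn₂ a b _))
                  (cong (punchOut₂ a b) (trans (sym (insertArc-other f x≢a x≢b)) e))))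
        x
    ; involutive = λ {x} → by-cases-on-arc (λ x → x < suc (suc k) → g (g x) ≡ x)
        (λ _ → trans (cong g (insertArc-a a b f)) (insertArc-b f a≢b))
        (λ _ → trans (cong g (insertArc-b f a≢b)) (insertArc-a a b f))
        (λ x x≢a x≢b h → invol x x≢a x≢b (y< h x≢a x≢b))
        x
    }
    where
    open ≡-Reasoning
    g = insertArc a b f
    y< : ∀ {x} → x < suc (suc k) → x ≢ a → x ≢ b → punchOut₂ a b x < k
    y< h x≢a x≢b = punchOut₂-< b<k+2 h x≢a x≢b
    invol : ∀ x → x ≢ a → x ≢ b → punchOut₂ a b x < k → g (g x) ≡ x
    invol x x≢a x≢b y<k = begin
      g (g x)
        ≡⟨ cong g (insertArc-other f x≢a x≢b) ⟩
      g (punchIn₂ a b (f y))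
        ≡⟨ insertArc-other f (punchIn₂-≢-a _) (punchIn₂-≢-b _) ⟩
      punchIn₂ a b (f (punchOut₂ a b (punchIn₂ a b (f y))))
        ≡⟨ cong (punchIn₂ a b ∘ f) (punchOut₂-punchIn₂ a b (f y)) ⟩
      punchIn₂ a b (f (f y))
        ≡⟨ cong (punchIn₂ a b) (involutive M y<k) ⟩
      punchIn₂ a b y
        ≡⟨ punchIn₂-punchOut₂ x≢a x≢b ⟩
      x ∎
      where y = punchOut₂ a b x

  removeArc-insertArc : ∀ f x → removeArc a b (insertArc a b f) x ≡ f x
  removeArc-insertArc f x =
    trans (cong (punchOut₂ a b) (insertArc-other f (punchIn₂-≢-a x) (punchIn₂-≢-b x)))
          (trans (punchOut₂-punchIn₂ a b _) (cong f (punchOut₂-punchIn₂ a b x)))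

  insertArc-cong : ∀ {k f f′} → (∀ y → y < k → f y ≡ f′ y) → b < suc (suc k) →
                   ∀ x → x < suc (suc k) → insertArc a b f x ≡ insertArc a b f′ x
  insertArc-cong {k} {f} {f′} f≗f′ b<k+2 =
    by-cases-on-arc (λ x → x < suc (suc k) → insertArc a b f x ≡ insertArc a b f′ x)
      (λ _ → trans (insertArc-a a b f) (sym (insertArc-a a b f′)))
      (λ _ → trans (insertArc-b f a≢b) (sym (insertArc-b f′ a≢b)))
      (λ x x≢a x≢b h → trans (insertArc-other f x≢a x≢b)
         (trans (cong (punchIn₂ a b) (f≗f′ _ (punchOut₂-< b<k+2 h x≢a x≢b)))
                (sym (insertArc-other f′ x≢a x≢b))))

  module _ {k : ℕ} {g : ℕ → ℕ} (b<k+2 : b < suc (suc k)) (M : Matching (suc (suc k)) g)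
           (gab : g a ≡ b) where

    private
      gba : g b ≡ a
      gba = trans (cong g (sym gab)) (involutive M (<-trans a<b b<k+2))

      ≢b⇒g≢a : ∀ {z} → z < suc (suc k) → z ≢ b → g z ≢ a
      ≢b⇒g≢a h z≢b e = z≢b (trans (sym (involutive M h)) (trans (cong g e) gab))

      ≢a⇒g≢b : ∀ {z} → z < suc (suc k) → z ≢ a → g z ≢ b
      ≢a⇒g≢b h z≢a e = z≢a (trans (sym (involutive M h)) (trans (cong g e) gba))

    removeArc-matching : Matching k (removeArc a b g)
    removeArc-matching = record
      { partner-<  = λ h → punchOut₂-< b<k+2 (partner-< M (z< h)) (≢b⇒g≢a (z< h) (punchIn₂-≢-b _))
                                                                  (≢a⇒g≢b (z< h) (punchIn₂-≢-a _))
      ; partner-≢  = λ {x} h e → partner-≢ M (z< h) (begin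
          g (punchIn₂ a b x)
            ≡⟨ punchIn₂-punchOut₂ (≢b⇒g≢a (z< h) (punchIn₂-≢-b _))
                                  (≢a⇒g≢b (z< h) (punchIn₂-≢-a _)) ⟨
          punchIn₂ a b (removeArc a b g x)    ≡⟨ cong (punchIn₂ a b) e ⟩
          punchIn₂ a b x                      ∎)
      ; involutive = λ {x} h → begin
          punchOut₂ a b (g (punchIn₂ a b (punchOut₂ a b (g (punchIn₂ a b x)))))
            ≡⟨ cong (punchOut₂ a b ∘ g) (punchIn₂-punchOut₂ (≢b⇒g≢a (z< h) (punchIn₂-≢-b _))
               (≢a⇒g≢b (z< h) (punchIn₂-≢-a _))) ⟩
          punchOut₂ a b (g (g (punchIn₂ a b x)))
            ≡⟨ cong (punchOut₂ a b) (involutive M (z< h)) ⟩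
          punchOut₂ a b (punchIn₂ a b x)
            ≡⟨ punchOut₂-punchIn₂ a b x ⟩
          x ∎
      }
      where
      open ≡-Reasoning
      z< : ∀ {x} → x < k → punchIn₂ a b x < suc (suc k)
      z< = punchIn₂-< a b

    insertArc-removeArc : ∀ x → x < suc (suc k) → insertArc a b (removeArc a b g) x ≡ g x
    insertArc-removeArc = by-cases-on-arc (λ x → x < suc (suc k) → insertArc a b (removeArc a b g) x ≡ g x)
      (λ _ → trans (insertArc-a a b _) (sym gab))
      (λ _ → trans (insertArc-b _ a≢b) (sym gba))
      (λ x x≢a x≢b h → trans (insertArc-other _ x≢a x≢b)
         (trans (cong (punchIn₂ a b ∘ punchOut₂ a b ∘ g) (punchIn₂-punchOut₂ x≢a x≢b))
                (punchIn₂-punchOut₂ (≢b⇒g≢a h x≢b) (≢a⇒g≢b h x≢a))))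

-- Occurrences of the pattern

record Occurrence (k : ℕ) (f : ℕ → ℕ) (i j : ℕ) : Set where
  constructor occurrence
  field
    gap   : suc (suc i) ≤ j
    bound : suc (suc j) ≤ k
    outer : f i ≡ suc j
    inner : f (suc i) ≡ j

  j<k : j < k
  j<k = ≤-trans (n≤1+n _) bound

  i+1<k : suc i < k
  i+1<k = ≤-trans gap (<⇒≤ j<k)

  i<k : i < k
  i<k = ≤-trans (n≤1+n _) i+1<k

open Occurrence

occurrence-cong : ∀ {k f f′ i j} → (∀ y → y < k → f y ≡ f′ y) →
                  Occurrence k f i j → Occurrence k f′ i j
occurrence-cong f≗f′ o = occurrence (gap o) (bound o)
  (trans (sym (f≗f′ _ (i<k o))) (outer o)) (trans (sym (f≗f′ _ (i+1<k o))) (inner o))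

occurrence-partner-j : ∀ {k f i j} → Matching k f → Occurrence k f i j → f j ≡ suc i
occurrence-partner-j M o = trans (cong _ (sym (inner o))) (involutive M (i+1<k o))

OccurrenceFree : ℕ → (ℕ → ℕ) → Set
OccurrenceFree k f = ∀ i j → ¬ Occurrence k f i j

occurrence-left≢right : ∀ {k f i j i′ j′} → Matching k f →
                        Occurrence k f i j → Occurrence k f i′ j′ → i ≢ j′
occurrence-left≢right M o o′ i≡j′ =
  <-irrefl refl (<-trans i′<j′ (subst (_< _) i≡j′ (subst (_ <_) j≡i′ i<j)))
  where
  j≡i′ = suc-injective (trans (sym (outer o)) (trans (cong _ i≡j′) (occurrence-partner-j M o′)))
  i<j  = ≤-trans (n≤1+n _) (gap o)
  i′<j′ = ≤-trans (n≤1+n _) (gap o′)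

occurrence-unique : ∀ {k f i j i′ j′} → Matching k f → Occurrence k f i j → Occurrence k f i′ j′ →
                    i ≡ i′ ⊎ j ≡ j′ ⊎ i ≡ j′ ⊎ j ≡ i′ → i ≡ i′ × j ≡ j′
occurrence-unique M o o′ (inj₁ refl) = refl , suc-injective (trans (sym (outer o)) (outer o′))
occurrence-unique M o o′ (inj₂ (inj₁ refl)) =
  suc-injective (trans (sym (occurrence-partner-j M o)) (occurrence-partner-j M o′)) , refl
occurrence-unique M o o′ (inj₂ (inj₂ (inj₁ i≡j′))) = ⊥-elim (occurrence-left≢right M o o′ i≡j′)
occurrence-unique M o o′ (inj₂ (inj₂ (inj₂ j≡i′))) =
  ⊥-elim (occurrence-left≢right M o′ o (sym j≡i′))

module _ {a b : ℕ} (a<b : a < b) where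

  occurrence-insertArc⁻ : ∀ {k f i j} → b < suc (suc k) → Matching k f →
    Occurrence (suc (suc k)) (insertArc a b f) i j →
    i ≢ a → i ≢ b → suc i ≢ a → suc i ≢ b → j ≢ a → j ≢ b →
    Occurrence k f (punchOut₂ a b i) (punchOut₂ a b j)
  occurrence-insertArc⁻ {k} {f} {i} {j} b<k+2 M o i≢a i≢b i+1≢a i+1≢b j≢a j≢b =
    occurrence gap′ bound′ outer′ inner′
    where
    i′ = punchOut₂ a b i
    j′ = punchOut₂ a b j
    i′+1 : punchOut₂ a b (suc i) ≡ suc i′
    i′+1 = punchOut₂-suc a<b i i≢a i≢b
    outer′ : f i′ ≡ suc j′
    outer′ = trans (sym (punchOut₂-punchIn₂ a b _))
      (trans (cong (punchOut₂ a b) (trans (sym (insertArc-other f i≢a i≢b)) (outer o)))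
             (punchOut₂-suc a<b j j≢a j≢b))
    inner′ : f (suc i′) ≡ j′
    inner′ = trans (cong f (sym i′+1)) (trans (sym (punchOut₂-punchIn₂ a b _))
      (cong (punchOut₂ a b) (trans (sym (insertArc-other f i+1≢a i+1≢b)) (inner o))))
    i′+1<k : suc i′ < k
    i′+1<k = subst (_< k) i′+1 (punchOut₂-< a<b b<k+2 (i+1<k o) i+1≢a i+1≢b)
    bound′ : suc (suc j′) ≤ k
    bound′ = subst (_< k) outer′ (partner-< M (punchOut₂-< a<b b<k+2 (i<k o) i≢a i≢b))
    gap′ : suc (suc i′) ≤ j′
    gap′ = ≤∧≢⇒< (subst (_≤ j′) i′+1 (punchOut₂-mono-≤ a b (≤-trans (n≤1+n _) (gap o))))
                 (λ e → partner-≢ M i′+1<k (trans inner′ (sym e)))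

  occurrence-insertArc⁺ : ∀ {k f i j} → b < suc (suc k) → Occurrence k f i j →
    suc (punchIn₂ a b i) ≢ a → suc (punchIn₂ a b i) ≢ b →
    suc (punchIn₂ a b j) ≢ a → suc (punchIn₂ a b j) ≢ b →
    Occurrence (suc (suc k)) (insertArc a b f) (punchIn₂ a b i) (punchIn₂ a b j)
  occurrence-insertArc⁺ {k} {f} {i} {j} b<k+2 o i+1≢a i+1≢b j+1≢a j+1≢b =
    occurrence gap′ bound′ outer′ inner′
    where
    g = insertArc a b f
    i+1′ : punchIn₂ a b (suc i) ≡ suc (punchIn₂ a b i)
    i+1′ = punchIn₂-suc a<b i i+1≢a i+1≢b
    j+1′ : punchIn₂ a b (suc j) ≡ suc (punchIn₂ a b j)
    j+1′ = punchIn₂-suc a<b j j+1≢a j+1≢b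
    g∘punchIn₂ : ∀ y → g (punchIn₂ a b y) ≡ punchIn₂ a b (f y)
    g∘punchIn₂ y = trans (insertArc-other f (punchIn₂-≢-a a<b y) (punchIn₂-≢-b a<b y))
                         (cong (punchIn₂ a b ∘ f) (punchOut₂-punchIn₂ a b y))
    outer′ : g (punchIn₂ a b i) ≡ suc (punchIn₂ a b j)
    outer′ = trans (g∘punchIn₂ i) (trans (cong (punchIn₂ a b) (outer o)) j+1′)
    inner′ : g (suc (punchIn₂ a b i)) ≡ punchIn₂ a b j
    inner′ = trans (cong g (sym i+1′)) (trans (g∘punchIn₂ (suc i)) (cong (punchIn₂ a b) (inner o)))
    gap′ : suc (suc (punchIn₂ a b i)) ≤ punchIn₂ a b j
    gap′ = subst (λ z → suc z ≤ punchIn₂ a b j) i+1′ (punchIn₂-mono-< a b (gap o))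
    bound′ : suc (suc (punchIn₂ a b j)) ≤ suc (suc k)
    bound′ = subst (λ z → suc z ≤ suc (suc k)) j+1′ (punchIn₂-< a b (bound o))

-- Closing a matching with an arc from p to a new last point K + 1. The new arc creates an
-- occurrence only as the outer arc over {p + 1, K}; an old occurrence (i, j) survives unless p
-- falls between i and i + 1 or between j and j + 1.
module InsertLast {K : ℕ} {f : ℕ → ℕ} {p : ℕ} (M : Matching K f) (p≤K : p < suc K) where

  g : ℕ → ℕ
  g = insertArc p (suc K) f

  private
    K+1<K+2 : suc K < suc (suc K)
    K+1<K+2 = n<1+n (suc K)

    punchOut₂-suc-p : suc p ≤ suc K → punchOut₂ p (suc K) (suc p) ≡ p
    punchOut₂-suc-p h = trans (cong (punchOut p) (punchOut-≤ h)) (punchOut-suc-self p)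

    punchOut₂≡punchOut : ∀ {x} → x ≤ suc K → punchOut₂ p (suc K) x ≡ punchOut p x
    punchOut₂≡punchOut h = cong (punchOut p) (punchOut-≤ h)

  occurrence-at-new-arc⁻ : ∀ {j} → Occurrence (suc (suc K)) g p j → (p < K) × (f p ≡ pred K)
  occurrence-at-new-arc⁻ {j} o = p<K , fp≡K-1
    where
    j≡K : j ≡ K
    j≡K = suc-injective (trans (sym (outer o)) (insertArc-a p (suc K) f))
    p+1≢K+1 : suc p ≢ suc K
    p+1≢K+1 e = <-irrefl (trans (suc-injective e) (sym j≡K)) (≤-trans (n≤1+n _) (gap o))
    p+1≤K+1 : suc p ≤ suc K
    p+1≤K+1 = ≤-trans (n≤1+n _) (≤-trans (gap o) (≤-trans (≤-pred (≤-pred (bound o))) (n≤1+n K)))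
    g-p+1 : punchIn₂ p (suc K) (f p) ≡ K
    g-p+1 = begin
      punchIn₂ p (suc K) (f p)
        ≡⟨ cong (punchIn₂ p (suc K) ∘ f) (punchOut₂-suc-p p+1≤K+1) ⟨
      punchIn₂ p (suc K) (f (punchOut₂ p (suc K) (suc p)))
        ≡⟨ insertArc-other f (λ e → <-irrefl (sym e) (n<1+n _)) p+1≢K+1 ⟨
      g (suc p)
        ≡⟨ inner o ⟩
      j
        ≡⟨ j≡K ⟩
      K ∎
      where open ≡-Reasoning
    p<K : p < K
    p<K = ≤∧≢⇒< (≤-pred p≤K) (λ e → punchIn₂-≢-a p≤K (f p) (trans g-p+1 (sym e)))
    fp≡K-1 : f p ≡ pred K
    fp≡K-1 = trans (sym (punchOut₂-punchIn₂ p (suc K) (f p)))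
      (trans (cong (punchOut₂ p (suc K)) g-p+1)
      (trans (punchOut₂≡punchOut (n≤1+n K)) (cong pred (punchOut-> p<K))))

  occurrence-at-new-arc⁺ : p < K → f p ≡ pred K → Occurrence (suc (suc K)) g p K
  occurrence-at-new-arc⁺ p<K fp≡K-1 = occurrence gap′ ≤-refl (insertArc-a p (suc K) f) inner′
    where
    gap′ : suc (suc p) ≤ K
    gap′ = ≤∧≢⇒< p<K (λ e → partner-≢ M p<K (trans fp≡K-1 (cong pred (sym e))))
    inner′ : g (suc p) ≡ K
    inner′ = begin
      g (suc p)
        ≡⟨ insertArc-other f (λ e → <-irrefl (sym e) (n<1+n p))
           (λ e → <-irrefl (suc-injective e) p<K) ⟩
      punchIn₂ p (suc K) (f (punchOut₂ p (suc K) (suc p)))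
        ≡⟨ cong (punchIn₂ p (suc K) ∘ f) (punchOut₂-suc-p (≤-trans p<K (n≤1+n K))) ⟩
      punchIn₂ p (suc K) (f p)
        ≡⟨ cong (punchIn₂ p (suc K)) fp≡K-1 ⟩
      punchIn (suc K) (punchIn p (pred K))
        ≡⟨ cong (punchIn (suc K)) (punchIn-pred p<K) ⟩
      punchIn (suc K) K
        ≡⟨ punchIn-< (n<1+n K) ⟩
      K ∎
      where open ≡-Reasoning

  occurrence-insertLast⁻ : ∀ {i j} → Occurrence (suc (suc K)) g i j →
    (p < K × f p ≡ pred K) ⊎
    Σ ℕ λ i′ → Σ ℕ λ j′ → Occurrence K f i′ j′ × p ≢ suc i′ × p ≢ suc j′
  occurrence-insertLast⁻ {i} {j} o with i ≟ p
  ... | yes refl = inj₁ (occurrence-at-new-arc⁻ o)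
  ... | no i≢p   =
    inj₂ (_ , _ , o′ , p≢suc-punchOut (<⇒≤ i<K+1) i≢p i+1≢p , p≢suc-punchOut j≤K+1 j≢p j+1≢p)
    where
    j≤K : j ≤ K
    j≤K = ≤-pred (≤-pred (bound o))
    j≤K+1 = ≤-trans j≤K (n≤1+n K)
    i+1<K : suc i < K
    i+1<K = <-≤-trans (gap o) j≤K
    i<K+1 : i < suc K
    i<K+1 = <-trans (≤-trans (n≤1+n _) i+1<K) (n<1+n K)
    i≢K+1 : i ≢ suc K
    i≢K+1 e = <-irrefl e i<K+1
    i+1≢K+1 : suc i ≢ suc K
    i+1≢K+1 e = <-irrefl e (<-trans i+1<K (n<1+n K))
    i+1≢p : suc i ≢ p
    i+1≢p e = <-irrefl (trans (sym (inner o)) (trans (cong g e) (insertArc-a p (suc K) f))) (s≤s j≤K)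
    j≢p : j ≢ p
    j≢p e = i+1≢K+1 (insertArc-≡-a p≤K f (suc i) (trans (inner o) e))
    j≢K+1 : j ≢ suc K
    j≢K+1 e = <-irrefl e (s≤s j≤K)
    j+1≢p : suc j ≢ p
    j+1≢p e = i≢K+1 (insertArc-≡-a p≤K f i (trans (outer o) e))
    o′ = occurrence-insertArc⁻ p≤K K+1<K+2 M o i≢p i≢K+1 i+1≢p i+1≢K+1 j≢p j≢K+1
    p≢suc-punchOut : ∀ {x} → x ≤ suc K → x ≢ p → suc x ≢ p → p ≢ suc (punchOut₂ p (suc K) x)
    p≢suc-punchOut h x≢p x+1≢p e =
      suc-punchOut-≢ x≢p x+1≢p (sym (trans e (cong suc (punchOut₂≡punchOut h))))

  occurrenceFree-insertLast : OccurrenceFree K f → p ≢ f (pred K) → OccurrenceFree (suc (suc K)) g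
  occurrenceFree-insertLast free p≢ i j o with occurrence-insertLast⁻ o
  ... | inj₁ (p<K , fp≡K-1)      = p≢ (trans (sym (involutive M p<K)) (cong f fp≡K-1))
  ... | inj₂ (i′ , j′ , o′ , _) = free i′ j′ o′

  occurrence-insertLast⁺ : ∀ {i j} → Occurrence K f i j → p ≢ suc i → p ≢ suc j →
    Occurrence (suc (suc K)) g (punchIn₂ p (suc K) i) (punchIn₂ p (suc K) j)
  occurrence-insertLast⁺ {i} {j} o p≢i+1 p≢j+1 =
    occurrence-insertArc⁺ p≤K K+1<K+2 o
      (suc-punchIn₂-≢-p i (i+1<k o) p≢i+1) (suc-punchIn₂-≢-K+1 i (i+1<k o))
      (suc-punchIn₂-≢-p j (bound o) p≢j+1) (suc-punchIn₂-≢-K+1 j (bound o))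
    where
    punchIn₂≡punchIn : ∀ x → suc x < K → punchIn₂ p (suc K) x ≡ punchIn p x
    punchIn₂≡punchIn x h = punchIn-< (≤-trans (s≤s (punchIn-≤ p x)) (<⇒≤ (s≤s h)))
    suc-punchIn₂-≢-p : ∀ x → suc x < K → p ≢ suc x → suc (punchIn₂ p (suc K) x) ≢ p
    suc-punchIn₂-≢-p x h p≢x+1 e with x <? p
    ... | yes x<p = p≢x+1 (trans (sym e) (cong suc (trans (punchIn₂≡punchIn x h) (punchIn-< x<p))))
    ... | no x≮p  = <-irrefl refl (≤-trans (s≤s (≤-trans (≮⇒≥ x≮p) (n≤1+n x)))
                      (≤-reflexive (trans (cong suc (trans (sym (punchIn-≥ (≮⇒≥ x≮p)))
                                                         (sym (punchIn₂≡punchIn x h)))) e)))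
    suc-punchIn₂-≢-K+1 : ∀ x → suc x < K → suc (punchIn₂ p (suc K) x) ≢ suc K
    suc-punchIn₂-≢-K+1 x h e =
      <-irrefl (suc-injective (trans (cong suc (sym (punchIn₂≡punchIn x h))) e))
               (≤-trans (s≤s (punchIn-≤ p x)) h)

-- Doubling the arc {l, r}: the new arc {l + 1, r + 1} is nested right inside it, and together
-- they form the occurrence (l, r + 1).
module DoubleArc {k : ℕ} {ν : ℕ → ℕ} {l r : ℕ} (M : Matching k ν) (l<r : l < r) (r<k : r < k)
                 (νl≡r : ν l ≡ r) where

  l+1<r+1 : suc l < suc r
  l+1<r+1 = s≤s l<r

  r+1<k+2 : suc r < suc (suc k)
  r+1<k+2 = s≤s (≤-trans r<k (n≤1+n k))

  doubled : ℕ → ℕ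
  doubled = insertArc (suc l) (suc r) ν

  doubled-matching : Matching (suc (suc k)) doubled
  doubled-matching = insertArc-matching l+1<r+1 r+1<k+2 M

  private
    νr≡l : ν r ≡ l
    νr≡l = trans (cong ν (sym νl≡r)) (involutive M (<-trans l<r r<k))

    punchOut₂-l : punchOut₂ (suc l) (suc r) l ≡ l
    punchOut₂-l = trans (cong (punchOut (suc l)) (punchOut-≤ (≤-trans (<⇒≤ l<r) (n≤1+n r))))
                        (punchOut-≤ (n≤1+n l))

    punchOut₂-l+2 : suc (suc l) ≤ suc r → punchOut₂ (suc l) (suc r) (suc (suc l)) ≡ suc l
    punchOut₂-l+2 h = trans (cong (punchOut (suc l)) (punchOut-≤ h)) (punchOut-suc-self (suc l))

    doubled-l : doubled l ≡ suc (suc r)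
    doubled-l = begin
      doubled l
        ≡⟨ insertArc-other ν (λ e → <-irrefl e (n<1+n l))
           (λ e → <-irrefl e (<-trans l<r (n<1+n r))) ⟩
      punchIn₂ (suc l) (suc r) (ν (punchOut₂ (suc l) (suc r) l))
        ≡⟨ cong (punchIn₂ (suc l) (suc r) ∘ ν) punchOut₂-l ⟩
      punchIn₂ (suc l) (suc r) (ν l)
        ≡⟨ cong (punchIn₂ (suc l) (suc r)) νl≡r ⟩
      punchIn (suc r) (punchIn (suc l) r)
        ≡⟨ cong (punchIn (suc r)) (punchIn-≥ l<r) ⟩
      punchIn (suc r) (suc r)
        ≡⟨ punchIn-≥ ≤-refl ⟩
      suc (suc r) ∎
      where open ≡-Reasoning

  occurrence-doubled : Occurrence (suc (suc k)) doubled l (suc r)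
  occurrence-doubled = occurrence (s≤s l<r) (s≤s (s≤s r<k)) doubled-l (insertArc-a (suc l) (suc r) ν)

  private
    -- Its inner arc would come from an arc nested right inside {l, r}, an occurrence in ν.
    new-arc-not-outer : OccurrenceFree k ν → ∀ {j} → ¬ Occurrence (suc (suc k)) doubled (suc l) j
    new-arc-not-outer free {j} o with suc (suc l) ≟ suc r
    ... | yes l+2≡r+1 =
      <⇒≱ (≤-trans (n≤1+n _) (gap o)) (≤-reflexive (trans (sym r≡j) (sym (suc-injective l+2≡r+1))))
      where
      r≡j = suc-injective (trans (sym (insertArc-a (suc l) (suc r) ν)) (outer o))
    ... | no l+2≢r+1 = free l q (occurrence gap′ bound′ (trans νl≡r (sym q+1≡r)) νl+1≡q)
      where
      r≡j = suc-injective (trans (sym (insertArc-a (suc l) (suc r) ν)) (outer o))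
      l+1<r : suc l < r
      l+1<r = ≤∧≢⇒< l<r (l+2≢r+1 ∘ cong suc)
      q = punchOut (suc l) r
      q+1≡r : suc q ≡ r
      q+1≡r = punchOut-> l+1<r
      ν-image : punchIn₂ (suc l) (suc r) (ν (suc l)) ≡ r
      ν-image = trans (sym (trans (insertArc-other ν (λ e → <-irrefl (sym e) (n<1+n (suc l))) l+2≢r+1)
                                  (cong (punchIn₂ (suc l) (suc r) ∘ ν) (punchOut₂-l+2 (s≤s l<r)))))
                      (trans (inner o) (sym r≡j))
      νl+1≡q : ν (suc l) ≡ q
      νl+1≡q = trans (sym (punchOut₂-punchIn₂ (suc l) (suc r) _))
                 (trans (cong (punchOut₂ (suc l) (suc r)) ν-image)
                        (cong (punchOut (suc l)) (punchOut-≤ (n≤1+n r))))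
      gap′ : suc (suc l) ≤ q
      gap′ = ≤∧≢⇒< (≤-pred (subst (suc (suc l) ≤_) (sym q+1≡r) l+1<r))
                   (λ e → partner-≢ M (≤-trans l+1<r (<⇒≤ r<k)) (trans νl+1≡q (sym e)))
      bound′ : suc (suc q) ≤ k
      bound′ = subst (λ z → suc z ≤ k) (sym q+1≡r) r<k

  doubled-occurrence-unique : OccurrenceFree k ν → ∀ {i j} → Occurrence (suc (suc k)) doubled i j →
                              i ≡ l × j ≡ suc r
  doubled-occurrence-unique free {i} {j} o with i ≟ l
  ... | yes i≡l = i≡l , proj₂ (occurrence-unique doubled-matching o occurrence-doubled (inj₁ i≡l))
  ... | no i≢l with i ≟ suc l
  ...   | yes refl = ⊥-elim (new-arc-not-outer free o)
  ...   | no i≢l+1 with i ≟ suc r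
  ...     | yes refl =
    ⊥-elim (<⇒≱ (≤-trans (n≤1+n _) (gap o))
                (≤-trans (≤-reflexive j≡l) (<⇒≤ (<-trans l<r (n<1+n r)))))
    where j≡l = suc-injective (trans (sym (outer o)) (insertArc-b ν (a≢b l+1<r+1)))
  ...     | no i≢r+1 with suc i ≟ suc r
  ...       | yes i+1≡r+1 =
    ⊥-elim (<⇒≱ (≤-trans (n≤1+n _) (gap o))
                (≤-trans (≤-reflexive j≡l+1) (≤-trans l<r (≤-reflexive (sym i≡r)))))
    where
    i≡r = suc-injective i+1≡r+1
    j≡l+1 = trans (sym (inner o)) (trans (cong doubled i+1≡r+1) (insertArc-b ν (a≢b l+1<r+1)))
  ...       | no i+1≢r+1 with j ≟ suc l
  ...         | yes j≡l+1 = ⊥-elim (i+1≢r+1 (insertArc-≡-a l+1<r+1 ν (suc i) (trans (inner o) j≡l+1)))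
  ...         | no j≢l+1 with j ≟ suc r
  ...           | yes j≡r+1 =
    ⊥-elim (i≢l (suc-injective (insertArc-≡-b l+1<r+1 ν (suc i) (trans (inner o) j≡r+1))))
  ...           | no j≢r+1 = ⊥-elim (free _ _ (occurrence-insertArc⁻ l+1<r+1 r+1<k+2 M o
                                i≢l+1 i≢r+1 (i≢l ∘ suc-injective) i+1≢r+1 j≢l+1 j≢r+1))

  private
    occurrence-below-new-arc : ∀ {j} → Occurrence k ν l j → Occurrence (suc (suc k)) doubled (suc l) r
    occurrence-below-new-arc {j} o = occurrence gap′ bound′ (insertArc-a (suc l) (suc r) ν) inner′
      where
      r≡j+1 : r ≡ suc j
      r≡j+1 = trans (sym νl≡r) (outer o)
      gap′ : suc (suc (suc l)) ≤ r
      gap′ = subst (suc (suc (suc l)) ≤_) (sym r≡j+1) (s≤s (gap o))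
      bound′ : suc (suc r) ≤ suc (suc k)
      bound′ = s≤s (s≤s (<⇒≤ r<k))
      l+2≢r+1 : suc (suc l) ≢ suc r
      l+2≢r+1 e = <⇒≱ (s≤s (≤-trans (n≤1+n _) (gap o)))
                      (≤-reflexive (sym (trans (suc-injective e) r≡j+1)))
      inner′ : doubled (suc (suc l)) ≡ r
      inner′ = begin
        doubled (suc (suc l))
          ≡⟨ insertArc-other ν (λ e → <-irrefl (sym e) (n<1+n (suc l))) l+2≢r+1 ⟩
        punchIn₂ (suc l) (suc r) (ν (punchOut₂ (suc l) (suc r) (suc (suc l))))
          ≡⟨ cong (punchIn₂ (suc l) (suc r) ∘ ν) (punchOut₂-l+2 (s≤s l<r)) ⟩
        punchIn₂ (suc l) (suc r) (ν (suc l))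
          ≡⟨ cong (punchIn₂ (suc l) (suc r)) (inner o) ⟩
        punchIn (suc r) (punchIn (suc l) j)
          ≡⟨ cong (punchIn (suc r)) (punchIn-≥ (≤-trans (n≤1+n _) (gap o))) ⟩
        punchIn (suc r) (suc j)
          ≡⟨ cong (punchIn (suc r)) (sym r≡j+1) ⟩
        punchIn (suc r) r
          ≡⟨ punchIn-< (n<1+n r) ⟩
        r ∎
        where open ≡-Reasoning

    suc-punchIn₂-≢-l+1 : ∀ y → y ≢ l → suc (punchIn₂ (suc l) (suc r) y) ≢ suc l
    suc-punchIn₂-≢-l+1 y y≢l e = y≢l (trans (sym (punchOut₂-punchIn₂ (suc l) (suc r) y))
      (trans (cong (punchOut₂ (suc l) (suc r)) (suc-injective e)) punchOut₂-l))

    suc-punchIn₂-≢-r+1 : ∀ y → suc y ≢ r → suc (punchIn₂ (suc l) (suc r) y) ≢ suc r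
    suc-punchIn₂-≢-r+1 y y+1≢r e = y+1≢r (begin
      suc y
        ≡⟨ cong suc (punchOut₂-punchIn₂ (suc l) (suc r) y) ⟨
      suc (punchOut₂ (suc l) (suc r) (punchIn₂ (suc l) (suc r) y))
        ≡⟨ cong (suc ∘ punchOut₂ (suc l) (suc r)) y↦r ⟩
      suc (punchOut (suc l) (punchOut (suc r) r))
        ≡⟨ cong (suc ∘ punchOut (suc l)) (punchOut-≤ (n≤1+n r)) ⟩
      suc (punchOut (suc l) r)
        ≡⟨ punchOut-> l+1<r ⟩
      r ∎)
      where
      open ≡-Reasoning
      y↦r : punchIn₂ (suc l) (suc r) y ≡ r
      y↦r = suc-injective e
      l+1<r : suc l < r
      l+1<r = ≤∧≢⇒< l<r (λ e′ → punchIn₂-≢-a l+1<r+1 y (trans y↦r (sym e′)))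

  occurrence-doubled⁺ : ∀ {i j} → Occurrence k ν i j →
    Σ ℕ λ i′ → Σ ℕ λ j′ → Occurrence (suc (suc k)) doubled i′ j′ × j′ ≢ suc r
  occurrence-doubled⁺ {i} {j} o with i ≟ l
  ... | yes refl = suc l , r , occurrence-below-new-arc o , (λ e → <-irrefl e (n<1+n r))
  ... | no i≢l with j ≟ l
  ...   | yes j≡l =
    ⊥-elim (<⇒≱ (gap o) (≤-trans (≤-reflexive j≡l) (≤-trans (<⇒≤ l<r) (≤-reflexive r≡i+1))))
    where
    r≡i+1 : r ≡ suc i
    r≡i+1 = trans (sym νl≡r) (trans (cong ν (sym (trans (inner o) j≡l))) (involutive M (i+1<k o)))
  ...   | no j≢l with suc i ≟ r
  ...     | yes i+1≡r = ⊥-elim (j≢l (trans (sym (inner o)) (trans (cong ν i+1≡r) νr≡l)))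
  ...     | no i+1≢r with suc j ≟ r
  ...       | yes j+1≡r =
    ⊥-elim (i≢l (trans (sym (involutive M (i<k o))) (trans (cong ν (trans (outer o) j+1≡r)) νr≡l)))
  ...       | no j+1≢r =
    punchIn₂ (suc l) (suc r) i , punchIn₂ (suc l) (suc r) j ,
    occurrence-insertArc⁺ l+1<r+1 r+1<k+2 o
      (suc-punchIn₂-≢-l+1 i i≢l) (suc-punchIn₂-≢-r+1 i i+1≢r)
      (suc-punchIn₂-≢-l+1 j j≢l) (suc-punchIn₂-≢-r+1 j j+1≢r) ,
    punchIn₂-≢-b l+1<r+1 j

-- From vectors to partner functions

Matchings : ℕ → Set
Matchings k = Vec (Fin k) k

-- Out of range, partner v is 0.
partner : ∀ {k} → Matchings k → ℕ → ℕ
partner {k} v x with x <? k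
... | yes x<k = toℕ (lookup v (fromℕ< x<k))
... | no _    = 0

partner-fromℕ< : ∀ {k} (v : Matchings k) {x} (x<k : x < k) → partner v x ≡ toℕ (lookup v (fromℕ< x<k))
partner-fromℕ< {k} v {x} x<k with x <? k
... | yes x<k′ = cong (λ h → toℕ (lookup v (fromℕ< h))) (<-irrelevant x<k′ x<k)
... | no x≮k   = ⊥-elim (x≮k x<k)

partner-toℕ : ∀ {k} (v : Matchings k) (i : Fin k) → partner v (toℕ i) ≡ toℕ (lookup v i)
partner-toℕ v i = trans (partner-fromℕ< v (toℕ<n i)) (cong (toℕ ∘ lookup v) (fromℕ<-toℕ i (toℕ<n i)))

partner-bounded : ∀ {k} (v : Matchings k) {x} → x < k → partner v x < k
partner-bounded v x<k = subst (_< _) (sym (partner-fromℕ< v x<k)) (toℕ<n _)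

partner-injective : ∀ {k} (v w : Matchings k) → (∀ x → x < k → partner v x ≡ partner w x) → v ≡ w
partner-injective v w v≗w =
  trans (sym (tabulate∘lookup v)) (trans (tabulate-cong pointwise) (tabulate∘lookup w))
  where
  pointwise : ∀ i → lookup v i ≡ lookup w i
  pointwise i = toℕ-injective
    (trans (sym (partner-toℕ v i)) (trans (v≗w (toℕ i) (toℕ<n i)) (partner-toℕ w i)))

-- Abstract: otherwise equations between vectors are checked by unfolding them entrywise,
-- which is prohibitively slow.
abstract
  toFinOr : ∀ {k} → ℕ → Fin k → Fin k
  toFinOr {k} y default with y <? k
  ... | yes y<k = fromℕ< y<k
  ... | no _    = default

  toℕ-toFinOr : ∀ {k y} (default : Fin k) → y < k → toℕ (toFinOr y default) ≡ y
  toℕ-toFinOr {k} {y} _ y<k with y <? k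
  ... | yes y<k′ = toℕ-fromℕ< y<k′
  ... | no y≮k   = ⊥-elim (y≮k y<k)

  fromPartner : (k : ℕ) → (ℕ → ℕ) → Matchings k
  fromPartner k g = tabulate (λ i → toFinOr (g (toℕ i)) i)

  partner-fromPartner : ∀ {k g x} → x < k → g x < k → partner (fromPartner k g) x ≡ g x
  partner-fromPartner {k} {g} {x} x<k gx<k = begin
    partner (fromPartner k g) x
      ≡⟨ partner-fromℕ< (fromPartner k g) x<k ⟩
    toℕ (lookup (fromPartner k g) i)
      ≡⟨ cong toℕ (lookup∘tabulate _ i) ⟩
    toℕ (toFinOr (g (toℕ i)) i)
      ≡⟨ toℕ-toFinOr i (subst (λ z → g z < k) (sym (toℕ-fromℕ< x<k)) gx<k) ⟩
    g (toℕ i)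
      ≡⟨ cong g (toℕ-fromℕ< x<k) ⟩
    g x ∎
    where
    open ≡-Reasoning
    i : Fin k
    i = fromℕ< x<k

isMatching⇒matching : ∀ {k} (v : Matchings k) → IsMatching v → Matching k (partner v)
isMatching⇒matching v isM = record
  { partner-<  = partner-bounded v
  ; partner-≢  = λ x<k e → proj₁ (isM (fromℕ< x<k))
      (toℕ-injective (trans (sym (partner-fromℕ< v x<k)) (trans e (sym (toℕ-fromℕ< x<k)))))
  ; involutive = λ {x} x<k → begin
      partner v (partner v x)                     ≡⟨ cong (partner v) (partner-fromℕ< v x<k) ⟩
      partner v (toℕ (lookup v (fromℕ< x<k)))     ≡⟨ partner-toℕ v _ ⟩
      toℕ (lookup v (lookup v (fromℕ< x<k)))      ≡⟨ cong toℕ (proj₂ (isM (fromℕ< x<k))) ⟩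
      toℕ (fromℕ< x<k)                            ≡⟨ toℕ-fromℕ< x<k ⟩
      x                                           ∎
  }
  where open ≡-Reasoning

matching⇒isMatching : ∀ {k} (v : Matchings k) → Matching k (partner v) → IsMatching v
matching⇒isMatching v M i =
  (λ e → partner-≢ M (toℕ<n i) (trans (partner-toℕ v i) (cong toℕ e))) ,
  toℕ-injective (begin
    toℕ (lookup v (lookup v i))      ≡⟨ partner-toℕ v (lookup v i) ⟨
    partner v (toℕ (lookup v i))     ≡⟨ cong (partner v) (partner-toℕ v i) ⟨
    partner v (partner v (toℕ i))    ≡⟨ involutive M (toℕ<n i) ⟩
    toℕ i                            ∎)
  where open ≡-Reasoning

arc⇒partner : ∀ {k} (v : Matchings k) {x y} → Arc v x y → partner v x ≡ y
arc⇒partner v (i , refl , lookup≡y) = trans (partner-toℕ v i) lookup≡y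

partner⇒arc : ∀ {k} (v : Matchings k) {x y} → x < k → partner v x ≡ y → Arc v x y
partner⇒arc v x<k e = fromℕ< x<k , toℕ-fromℕ< x<k , trans (sym (partner-fromℕ< v x<k)) e

occ21⇒occurrence : ∀ {k} (v : Matchings k) → Occ21 v →
                   Σ ℕ λ i → Σ ℕ λ j → Occurrence k (partner v) i j
occ21⇒occurrence {k} v (i , j , i+2≤j , j+2≤k , outer-arc , inner-arc) = toℕ i , toℕ j ,
  occurrence (subst (_≤ toℕ j) (+-comm (toℕ i) 2) i+2≤j) (subst (_≤ k) (+-comm (toℕ j) 2) j+2≤k)
    (trans (arc⇒partner v outer-arc) (+-comm _ 1))
    (trans (cong (partner v) (+-comm 1 _)) (arc⇒partner v inner-arc))

occurrence⇒occ21 : ∀ {k} (v : Matchings k) {i j} → Occurrence k (partner v) i j → Occ21 v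
occurrence⇒occ21 {k} v {i} {j} o =
  fromℕ< (i<k o) , fromℕ< (j<k o) ,
  subst₂ (λ a b → a + 2 ≤ b) (sym ti) (sym tj) (subst (_≤ j) (+-comm 2 i) (gap o)) ,
  subst (λ a → a + 2 ≤ k) (sym tj) (subst (_≤ k) (+-comm 2 j) (bound o)) ,
  subst₂ (Arc v) (sym ti) (cong (_+ 1) (sym tj)) (partner⇒arc v (i<k o) (trans (outer o) (+-comm 1 j))) ,
  subst₂ (Arc v) (cong (_+ 1) (sym ti)) (sym tj)
    (partner⇒arc v (subst (_< k) (+-comm 1 i) (i+1<k o)) (trans (cong (partner v) (+-comm i 1)) (inner o)))
  where
  ti = toℕ-fromℕ< (i<k o)
  tj = toℕ-fromℕ< (j<k o)

Avoiding : ℕ → (ℕ → ℕ) → Set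
Avoiding k f = Matching k f × OccurrenceFree k f

avoids21⇒avoiding : ∀ {k} (v : Matchings k) → Avoids21 v → Avoiding k (partner v)
avoids21⇒avoiding v (isM , no-occ) = isMatching⇒matching v isM , λ i j o → no-occ (occurrence⇒occ21 v o)

avoiding⇒avoids21 : ∀ {k} (v : Matchings k) → Avoiding k (partner v) → Avoids21 v
avoiding⇒avoids21 v (M , free) =
  matching⇒isMatching v M , λ o → let (i , j , o′) = occ21⇒occurrence v o in free i j o′

allVecs-cartesianProduct : ∀ k m → allVecs (suc k) m ≡ cartesianProductWith _∷_ (allFin m) (allVecs k m)
allVecs-cartesianProduct k m = go (allFin m)
  where
  go : ∀ xs → concatMap (λ x → map (x ∷_) (allVecs k m)) xs ≡ cartesianProductWith _∷_ xs (allVecs k m)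
  go []       = refl
  go (x ∷ xs) = cong (map (x ∷_) (allVecs k m) ++_) (go xs)

allVecs-unique : ∀ k m → Unique (allVecs k m)
allVecs-unique zero    m = All.[] ∷ []
allVecs-unique (suc k) m rewrite allVecs-cartesianProduct k m =
  cartesianProductWith⁺ _∷_ ∷-injective (allFin⁺ m) (allVecs-unique k m)

∈-allVecs : ∀ k m (v : Vec (Fin m) k) → v ∈ allVecs k m
∈-allVecs zero    m []      = here refl
∈-allVecs (suc k) m (x ∷ v) rewrite allVecs-cartesianProduct k m =
  ∈-cartesianProductWith⁺ _∷_ (∈-allFin x) (∈-allVecs k m v)

-- Kept abstract so that membership goals never unfold the enumeration.
abstract
  avoiders : (k : ℕ) → List (Matchings k)
  avoiders k = filter avoids21? (allVecs k k)

  a0≡length-avoiders : ∀ n → a0 n ≡ length (avoiders (2 * n))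
  a0≡length-avoiders n = refl

  avoiders-unique : ∀ k → Unique (avoiders k)
  avoiders-unique k = filter⁺ avoids21? (allVecs-unique k k)

  ∈-avoiders⁺ : ∀ {k} {v : Matchings k} → Avoids21 v → v ∈ avoiders k
  ∈-avoiders⁺ {k} {v} = ∈-filter⁺ avoids21? (∈-allVecs k k v)

  ∈-avoiders⁻ : ∀ {k} {v : Matchings k} → v ∈ avoiders k → Avoids21 v
  ∈-avoiders⁻ {k} v∈ = proj₂ (∈-filter⁻ avoids21? {xs = allVecs k k} v∈)

insertLast : ∀ {K} → ℕ → Matchings K → Matchings (suc (suc K))
insertLast {K} p v = fromPartner (suc (suc K)) (insertArc p (suc K) (partner v))

lastPartner : ∀ {K} → Matchings (suc (suc K)) → ℕ
lastPartner {K} w = partner w (suc K)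

removeLast : ∀ {K} → Matchings (suc (suc K)) → Matchings K
removeLast {K} w = fromPartner K (removeArc (lastPartner w) (suc K) (partner w))

module _ {K : ℕ} (v : Matchings K) {p : ℕ} (p≤K : p < suc K) (M : Matching K (partner v)) where

  private
    inserted-matching : Matching (suc (suc K)) (insertArc p (suc K) (partner v))
    inserted-matching = insertArc-matching p≤K (n<1+n (suc K)) M

  partner-insertLast : ∀ x → x < suc (suc K) → partner (insertLast p v) x ≡ insertArc p (suc K) (partner v) x
  partner-insertLast x x<K+2 =
    partner-fromPartner {g = insertArc p (suc K) (partner v)} x<K+2 (partner-< inserted-matching x<K+2)

  insertLast-matching : Matching (suc (suc K)) (partner (insertLast p v))
  insertLast-matching = matching-cong (λ x h → sym (partner-insertLast x h)) inserted-matching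

  lastPartner-insertLast : lastPartner (insertLast p v) ≡ p
  lastPartner-insertLast =
    trans (partner-insertLast (suc K) (n<1+n (suc K))) (insertArc-b (partner v) (<⇒≢ p≤K))

  removeLast-insertLast : removeLast (insertLast p v) ≡ v
  removeLast-insertLast = partner-injective _ _ pointwise
    where
    pointwise : ∀ x → x < K → partner (removeLast (insertLast p v)) x ≡ partner v x
    pointwise x x<K =
      trans (partner-fromPartner {g = removeArc (lastPartner (insertLast p v)) (suc K) (partner (insertLast p v))}
                                 x<K (subst (_< K) (sym removed) (partner-bounded v x<K)))
            removed
      where
      open ≡-Reasoning
      removed : removeArc (lastPartner (insertLast p v)) (suc K) (partner (insertLast p v)) x ≡ partner v x
      removed = begin
        removeArc (lastPartner (insertLast p v)) (suc K) (partner (insertLast p v)) x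
          ≡⟨ cong (λ q → removeArc q (suc K) (partner (insertLast p v)) x) lastPartner-insertLast ⟩
        punchOut₂ p (suc K) (partner (insertLast p v) (punchIn₂ p (suc K) x))
          ≡⟨ cong (punchOut₂ p (suc K)) (partner-insertLast _ (punchIn₂-< p (suc K) x<K)) ⟩
        removeArc p (suc K) (insertArc p (suc K) (partner v)) x
          ≡⟨ removeArc-insertArc p≤K (partner v) x ⟩
        partner v x ∎

module _ {K : ℕ} (w : Matchings (suc (suc K))) (M : Matching (suc (suc K)) (partner w)) where

  private
    K+1<K+2 : suc K < suc (suc K)
    K+1<K+2 = n<1+n (suc K)

  lastPartner-< : lastPartner w < suc K
  lastPartner-< = ≤∧≢⇒< (≤-pred (partner-< M K+1<K+2)) (partner-≢ M K+1<K+2)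

  private
    removed-matching : Matching K (removeArc (lastPartner w) (suc K) (partner w))
    removed-matching = removeArc-matching lastPartner-< K+1<K+2 M (involutive M K+1<K+2)

  partner-removeLast : ∀ x → x < K →
                       partner (removeLast w) x ≡ removeArc (lastPartner w) (suc K) (partner w) x
  partner-removeLast x x<K =
    partner-fromPartner {g = removeArc (lastPartner w) (suc K) (partner w)} x<K (partner-< removed-matching x<K)

  removeLast-matching : Matching K (partner (removeLast w))
  removeLast-matching = matching-cong (λ x h → sym (partner-removeLast x h)) removed-matching

  insertArc-removeLast : ∀ x → x < suc (suc K) →
                         insertArc (lastPartner w) (suc K) (partner (removeLast w)) x ≡ partner w x
  insertArc-removeLast x x<K+2 =
    trans (insertArc-cong lastPartner-< partner-removeLast K+1<K+2 x x<K+2)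
          (insertArc-removeArc lastPartner-< K+1<K+2 M (involutive M K+1<K+2) x x<K+2)

  insertLast-removeLast : insertLast (lastPartner w) (removeLast w) ≡ w
  insertLast-removeLast = partner-injective _ _ λ x x<K+2 →
    trans (partner-insertLast (removeLast w) lastPartner-< removeLast-matching x x<K+2) (insertArc-removeLast x x<K+2)

-- Removing the last arc without creating an occurrence

module _ (K₁ : ℕ) where

  private
    K = suc K₁

  lastPartner-≢ : ∀ (w : Matchings (suc (suc K))) → Avoids21 w → lastPartner w ≢ partner (removeLast w) K₁
  lastPartner-≢ w w-avoids p≡ = proj₂ (avoids21⇒avoiding w w-avoids) _ _
    (occurrence-cong (insertArc-removeLast w M)
      (InsertLast.occurrence-at-new-arc⁺ M′ (lastPartner-< w M) p<K fp≡K₁))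
    where
    M  = proj₁ (avoids21⇒avoiding w w-avoids)
    M′ = removeLast-matching w M
    p<K : lastPartner w < K
    p<K = subst (_< K) (sym p≡) (partner-< M′ (n<1+n K₁))
    fp≡K₁ : partner (removeLast w) (lastPartner w) ≡ K₁
    fp≡K₁ = trans (cong (partner (removeLast w)) p≡) (involutive M′ (n<1+n K₁))

  -- w on K + 2 points is determined by v = removeLast w and p = lastPartner w. When v avoids the
  -- pattern, w does exactly when p ≠ c, the partner of K₁ in v (otherwise (p, K) is an occurrence);
  -- the K admissible values of p are punchIn c q for q < K.
  extend : Matchings K × ℕ → Matchings (suc (suc K))
  extend (v , q) = insertLast (punchIn (partner v K₁) q) v

  restrict : Matchings (suc (suc K)) → Matchings K × ℕ
  restrict w = removeLast w , punchOut (partner (removeLast w) K₁) (lastPartner w)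

  private
    extendable = cartesianProduct (avoiders K) (upTo K)
    restrictable = filter (λ w → avoids21? (removeLast w)) (avoiders (suc (suc K)))

    module Extend (v : Matchings K) {q : ℕ} (v-avoids : Avoids21 v) (q<K : q < K) where
      M = proj₁ (avoids21⇒avoiding v v-avoids)
      c = partner v K₁
      p = punchIn c q
      p≤K : p < suc K
      p≤K = s≤s (≤-trans (punchIn-≤ c q) q<K)

      extend-∈ : extend (v , q) ∈ restrictable
      extend-∈ = ∈-filter⁺ (λ w → avoids21? (removeLast w))
        (∈-avoiders⁺ (avoiding⇒avoids21 (insertLast p v) (insertLast-matching v p≤K M ,
          λ i j o → InsertLast.occurrenceFree-insertLast M p≤K (proj₂ (avoids21⇒avoiding v v-avoids))
                      (punchIn-≢ c q) i j (occurrence-cong (partner-insertLast v p≤K M) o))))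
        (subst Avoids21 (sym (removeLast-insertLast v p≤K M)) v-avoids)

      restrict-extend : restrict (extend (v , q)) ≡ (v , q)
      restrict-extend = cong₂ _,_ (removeLast-insertLast v p≤K M) (begin
        punchOut (partner (removeLast (insertLast p v)) K₁) (lastPartner (insertLast p v))
          ≡⟨ cong₂ (λ u p′ → punchOut (partner u K₁) p′)
                   (removeLast-insertLast v p≤K M) (lastPartner-insertLast v p≤K M) ⟩
        punchOut c (punchIn c q)
          ≡⟨ punchOut-punchIn c q ⟩
        q ∎)
        where open ≡-Reasoning

    module Restrict (w : Matchings (suc (suc K))) (w-avoids : Avoids21 w) where
      M = proj₁ (avoids21⇒avoiding w w-avoids)
      c = partner (removeLast w) K₁
      p≢c = lastPartner-≢ w w-avoids

      restrict-∈ : Avoids21 (removeLast w) → restrict w ∈ extendable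
      restrict-∈ v-avoids = ∈-cartesianProduct⁺ (∈-avoiders⁺ v-avoids)
        (∈-upTo⁺ (punchOut-< (m<n⇒m<1+n (partner-< (removeLast-matching w M) (n<1+n K₁)))
                             (lastPartner-< w M) p≢c))

      extend-restrict : extend (restrict w) ≡ w
      extend-restrict = trans (cong (λ p → insertLast p (removeLast w)) (punchIn-punchOut p≢c))
                              (insertLast-removeLast w M)

    open Extend using (extend-∈; restrict-extend)
    open Restrict using (restrict-∈; extend-restrict)

  length-removeLast-avoiding :
    length (filter (λ w → avoids21? (removeLast w)) (avoiders (suc (suc K)))) ≡ length (avoiders K) * K
  length-removeLast-avoiding = begin
    length restrictable                     ≡⟨ extendable↔restrictable ⟨
    length extendable                       ≡⟨ length-cartesianProduct (avoiders K) (upTo K) ⟩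
    length (avoiders K) * length (upTo K)   ≡⟨ cong (length (avoiders K) *_) (length-upTo K) ⟩
    length (avoiders K) * K                 ∎
    where
    open ≡-Reasoning
    avoids : ∀ {v q} → (v , q) ∈ extendable → Avoids21 v
    avoids vq∈ = ∈-avoiders⁻ (proj₁ (∈-cartesianProduct⁻ (avoiders K) (upTo K) vq∈))
    bounded : ∀ {v q} → (v , q) ∈ extendable → q < K
    bounded vq∈ = ∈-upTo⁻ (proj₂ (∈-cartesianProduct⁻ (avoiders K) (upTo K) vq∈))
    restrictable⁻ : ∀ {w} → w ∈ restrictable → Avoids21 w × Avoids21 (removeLast w)
    restrictable⁻ w∈ =
      let (w∈′ , v-avoids) = ∈-filter⁻ (λ w → avoids21? (removeLast w)) {xs = avoiders (suc (suc K))} w∈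
      in ∈-avoiders⁻ w∈′ , v-avoids
    extendable↔restrictable : length extendable ≡ length restrictable
    extendable↔restrictable = length-≡-bijection extendable restrictable
      (cartesianProduct⁺ (avoiders-unique K) (upTo⁺ K)) (filter⁺ _ (avoiders-unique (suc (suc K))))
      extend restrict
      (λ { {v , q} vq∈ → extend-∈ v (avoids vq∈) (bounded vq∈) })
      (λ {w} w∈ → restrict-∈ w (proj₁ (restrictable⁻ w∈)) (proj₂ (restrictable⁻ w∈)))
      (λ { {v , q} vq∈ → restrict-extend v (avoids vq∈) (bounded vq∈) })
      (λ {w} w∈ → extend-restrict w (proj₁ (restrictable⁻ w∈)))

-- Removing the last arc and creating an occurrence

module _ (k : ℕ) where

  private
    K = suc (suc k)

  doubleV : Matchings k → ℕ → ℕ → Matchings K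
  doubleV ν l r = fromPartner K (insertArc (suc l) (suc r) (partner ν))

  -- The arc {x, partner ν x} is doubled, and the last point is attached to one of the two new
  -- positions next to it, chosen by whether x is its left or its right endpoint. (Abstract, like
  -- backward below, for the same reason as fromPartner.)
  abstract
    forward : Matchings k × ℕ → Matchings (suc (suc K))
    forward (ν , x) with x <? partner ν x
    ... | yes _ = insertLast (suc x) (doubleV ν x (partner ν x))
    ... | no _  = insertLast (suc (suc x)) (doubleV ν (partner ν x) x)

    forward-< : ∀ ν x → x < partner ν x →
                forward (ν , x) ≡ insertLast (suc x) (doubleV ν x (partner ν x))
    forward-< ν x x<y with x <? partner ν x
    ... | yes _ = refl
    ... | no x≮y = ⊥-elim (x≮y x<y)

    forward-≮ : ∀ ν x → ¬ x < partner ν x →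
                forward (ν , x) ≡ insertLast (suc (suc x)) (doubleV ν (partner ν x) x)
    forward-≮ ν x x≮y with x <? partner ν x
    ... | yes x<y = ⊥-elim (x≮y x<y)
    ... | no _    = refl

  chooseEnd : ℕ → ℕ → ℕ → ℕ
  chooseEnd p i j with p ≟ suc i
  ... | yes _ = i
  ... | no _  = pred j

  chooseEnd-≡ : ∀ {p i} j → p ≡ suc i → chooseEnd p i j ≡ i
  chooseEnd-≡ {p} {i} j p≡i+1 with p ≟ suc i
  ... | yes _    = refl
  ... | no p≢i+1 = ⊥-elim (p≢i+1 p≡i+1)

  chooseEnd-≢ : ∀ {p i} j → p ≢ suc i → chooseEnd p i j ≡ pred j
  chooseEnd-≢ {p} {i} j p≢i+1 with p ≟ suc i
  ... | yes p≡i+1 = ⊥-elim (p≢i+1 p≡i+1)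
  ... | no _      = refl

  chooseEnd-< : ∀ p {i j m} → i < m → pred j < m → chooseEnd p i j < m
  chooseEnd-< p {i} i<m j-1<m with p ≟ suc i
  ... | yes _ = i<m
  ... | no _  = j-1<m

  -- For the occurrence (i, j) of removeLast w: remove its inner arc, and record the end of the
  -- merged arc {i, j − 1} next to which the last arc was attached.
  decode : Matchings (suc (suc K)) → ℕ → ℕ → Matchings k × ℕ
  decode w i j = fromPartner k (removeArc (suc i) j (partner (removeLast w))) , chooseEnd (lastPartner w) i j

  decodeFound : (w : Matchings (suc (suc K))) → Dec (Occ21 (removeLast w)) → Matchings k × ℕ
  decodeFound w (yes o) = let (i , j , _) = occ21⇒occurrence (removeLast w) o in decode w i j
  decodeFound w (no _)  = decode w 0 0

  -- When removeLast w avoids the pattern, the value of backward w is irrelevant.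
  abstract
    backward : Matchings (suc (suc K)) → Matchings k × ℕ
    backward w = decodeFound w (occ21? (removeLast w))

    backward-decode : ∀ w → ¬ Avoids21 (removeLast w) → IsMatching (removeLast w) →
      Σ ℕ λ i → Σ ℕ λ j → Occurrence K (partner (removeLast w)) i j × backward w ≡ decode w i j
    backward-decode w not-avoids isM = found (occ21? (removeLast w))
      where
      found : (d : Dec (Occ21 (removeLast w))) →
              Σ ℕ λ i → Σ ℕ λ j → Occurrence K (partner (removeLast w)) i j × decodeFound w d ≡ decode w i j
      found (yes o) = let (i , j , o′) = occ21⇒occurrence (removeLast w) o in i , j , o′ , refl
      found (no ¬o) = ⊥-elim (not-avoids (isM , ¬o))

  Decoding : Matchings (suc (suc K)) → Set
  Decoding w = Σ ℕ λ i → Σ ℕ λ j → Occurrence K (partner (removeLast w)) i j × backward w ≡ decode w i j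

  module Doubling (ν : Matchings k) (ν-avoids : Avoids21 ν) {l r : ℕ} (l<r : l < r) (r<k : r < k)
                  (νl≡r : partner ν l ≡ r) {p : ℕ} (p-cases : p ≡ suc l ⊎ p ≡ suc (suc r)) where

    private
      M = proj₁ (avoids21⇒avoiding ν ν-avoids)
      free = proj₂ (avoids21⇒avoiding ν ν-avoids)
    open DoubleArc M l<r r<k νl≡r

    partner-doubleV : ∀ x → x < K → partner (doubleV ν l r) x ≡ doubled x
    partner-doubleV x x<K = partner-fromPartner {g = doubled} x<K (partner-< doubled-matching x<K)

    doubleV-matching : Matching K (partner (doubleV ν l r))
    doubleV-matching = matching-cong (λ x h → sym (partner-doubleV x h)) doubled-matching

    private
      l<K : l < K
      l<K = <-trans (<-trans l<r r<k) (≤-trans (n<1+n k) (n≤1+n (suc k)))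

    p≤K : p < suc K
    p≤K = [ (λ p≡l+1 → subst (_< suc K) (sym p≡l+1) (s≤s l<K))
          , (λ p≡r+2 → subst (_< suc K) (sym p≡r+2) (s≤s (s≤s (s≤s (<⇒≤ r<k))))) ]′ p-cases

    w : Matchings (suc (suc K))
    w = insertLast p (doubleV ν l r)

    private
      new-arc-harmless : ¬ (p < K × partner (doubleV ν l r) p ≡ pred K)
      new-arc-harmless (p<K , Dp≡k+1) = [ at-l+1 , at-r+2 ]′ p-cases
        where
        doubled-p : doubled p ≡ suc k
        doubled-p = trans (sym (partner-doubleV p p<K)) Dp≡k+1
        at-l+1 : p ≢ suc l
        at-l+1 p≡l+1 = <-irrefl (suc-injective (trans (sym (insertArc-a (suc l) (suc r) (partner ν)))
                                                      (trans (cong doubled (sym p≡l+1)) doubled-p))) r<k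
        at-r+2 : p ≢ suc (suc r)
        at-r+2 p≡r+2 = <⇒≱ (<-trans l<r r<k) (≤-trans (n≤1+n k) (≤-reflexive (sym l≡k+1)))
          where
          l≡k+1 : l ≡ suc k
          l≡k+1 = trans (sym (trans (cong doubled (sym (outer occurrence-doubled)))
                                    (involutive doubled-matching l<K)))
                        (trans (cong doubled (sym p≡r+2)) doubled-p)

      old-occurrences-destroyed : ¬ (Σ ℕ λ i′ → Σ ℕ λ j′ →
        Occurrence K (partner (doubleV ν l r)) i′ j′ × p ≢ suc i′ × p ≢ suc j′)
      old-occurrences-destroyed (i′ , j′ , o , p≢i′+1 , p≢j′+1)
        with doubled-occurrence-unique free (occurrence-cong partner-doubleV o)
      ... | refl , refl = [ p≢i′+1 , p≢j′+1 ]′ p-cases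

    w-avoids : Avoids21 w
    w-avoids = avoiding⇒avoids21 w (insertLast-matching (doubleV ν l r) p≤K doubleV-matching , λ i j o →
      [ new-arc-harmless , old-occurrences-destroyed ]′
        (InsertLast.occurrence-insertLast⁻ doubleV-matching p≤K
           (occurrence-cong (partner-insertLast (doubleV ν l r) p≤K doubleV-matching) o)))

    removeLast-w : removeLast w ≡ doubleV ν l r
    removeLast-w = removeLast-insertLast (doubleV ν l r) p≤K doubleV-matching

    removeLast-w-not-avoiding : ¬ Avoids21 (removeLast w)
    removeLast-w-not-avoiding avoids =
      proj₂ (avoids21⇒avoiding (doubleV ν l r) (subst Avoids21 removeLast-w avoids)) l (suc r)
      (occurrence-cong (λ x h → sym (partner-doubleV x h)) occurrence-doubled)

    w-∈ : w ∈ filter (λ w → ¬? (avoids21? (removeLast w))) (avoiders (suc (suc K)))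
    w-∈ = ∈-filter⁺ (λ w → ¬? (avoids21? (removeLast w))) (∈-avoiders⁺ w-avoids)
                    removeLast-w-not-avoiding

    backward-w : backward w ≡ (ν , chooseEnd p l (suc r))
    backward-w =
      let (i , j , o , backward≡) = backward-decode w removeLast-w-not-avoiding
                                      (matching⇒isMatching (removeLast w) (removeLast-matching w w-matching))
          (i≡l , j≡r+1) = doubled-occurrence-unique free (occurrence-cong partner-removeLast-w o)
      in trans backward≡ (trans (cong₂ (decode w) i≡l j≡r+1) (cong₂ _,_ undouble chooseEnd-p))
      where
      w-matching : Matching (suc (suc K)) (partner w)
      w-matching = insertLast-matching (doubleV ν l r) p≤K doubleV-matching
      partner-removeLast-w : ∀ x → x < K → partner (removeLast w) x ≡ doubled x
      partner-removeLast-w x x<K = trans (cong (λ u → partner u x) removeLast-w) (partner-doubleV x x<K)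
      chooseEnd-p : chooseEnd (lastPartner w) l (suc r) ≡ chooseEnd p l (suc r)
      chooseEnd-p = cong (λ q → chooseEnd q l (suc r))
                         (lastPartner-insertLast (doubleV ν l r) p≤K doubleV-matching)
      undoubled≗ν : ∀ x → x < k → removeArc (suc l) (suc r) (partner (removeLast w)) x ≡ partner ν x
      undoubled≗ν x x<k =
        trans (cong (punchOut₂ (suc l) (suc r)) (partner-removeLast-w _ (punchIn₂-< (suc l) (suc r) x<k)))
              (removeArc-insertArc l+1<r+1 (partner ν) x)
      undouble : fromPartner k (removeArc (suc l) (suc r) (partner (removeLast w))) ≡ ν
      undouble = partner-injective _ ν λ x x<k →
        trans (partner-fromPartner {g = removeArc (suc l) (suc r) (partner (removeLast w))} x<k
                 (subst (_< k) (sym (undoubled≗ν x x<k)) (partner-bounded ν x<k)))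
              (undoubled≗ν x x<k)

  module Undoubling (w : Matchings (suc (suc K))) (w-avoids : Avoids21 w) where

    private
      Mw   = proj₁ (avoids21⇒avoiding w w-avoids)
      v    = removeLast w
      Mv   = removeLast-matching w Mw
      p    = lastPartner w

    occurrence-separated : ∀ {i j} → Occurrence K (partner v) i j → p ≡ suc i ⊎ p ≡ suc j
    occurrence-separated {i} {j} o = by-cases (p ≟ suc i) (p ≟ suc j)
      where
      by-cases : Dec (p ≡ suc i) → Dec (p ≡ suc j) → p ≡ suc i ⊎ p ≡ suc j
      by-cases (yes p≡i+1) _            = inj₁ p≡i+1
      by-cases (no _)      (yes p≡j+1)  = inj₂ p≡j+1
      by-cases (no p≢i+1)  (no p≢j+1)   = ⊥-elim (proj₂ (avoids21⇒avoiding w w-avoids) _ _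
        (occurrence-cong (insertArc-removeLast w Mw)
          (InsertLast.occurrence-insertLast⁺ Mv (lastPartner-< w Mw) o p≢i+1 p≢j+1)))

    occurrence-unique-removeLast : ∀ {i j i′ j′} →
                                   Occurrence K (partner v) i j → Occurrence K (partner v) i′ j′ →
                                   i′ ≡ i × j′ ≡ j
    occurrence-unique-removeLast {i} {j} {i′} {j′} o o′ =
      occurrence-unique Mv o′ o (shared-end (occurrence-separated o′) (occurrence-separated o))
      where
      shared-end : p ≡ suc i′ ⊎ p ≡ suc j′ → p ≡ suc i ⊎ p ≡ suc j →
                   i′ ≡ i ⊎ j′ ≡ j ⊎ i′ ≡ j ⊎ j′ ≡ i
      shared-end (inj₁ a) (inj₁ b) = inj₁ (suc-injective (trans (sym a) b))
      shared-end (inj₁ a) (inj₂ b) = inj₂ (inj₂ (inj₁ (suc-injective (trans (sym a) b))))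
      shared-end (inj₂ a) (inj₁ b) = inj₂ (inj₂ (inj₂ (suc-injective (trans (sym a) b))))
      shared-end (inj₂ a) (inj₂ b) = inj₂ (inj₁ (suc-injective (trans (sym a) b)))

    module _ {i r : ℕ} (o : Occurrence K (partner v) i (suc r)) where

      private
        i<r : i < r
        i<r = ≤-pred (gap o)
        r<k : r < k
        r<k = ≤-pred (≤-pred (bound o))
        i+1<r+1 : suc i < suc r
        i+1<r+1 = s≤s i<r
        r+1<k+2 : suc r < suc (suc k)
        r+1<k+2 = s≤s (s≤s (<⇒≤ r<k))

        undoubled : ℕ → ℕ
        undoubled = removeArc (suc i) (suc r) (partner v)

        undoubled-matching : Matching k undoubled
        undoubled-matching = removeArc-matching i+1<r+1 r+1<k+2 Mv (inner o)

        ν : Matchings k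
        ν = fromPartner k undoubled

        partner-ν : ∀ x → x < k → partner ν x ≡ undoubled x
        partner-ν x x<k = partner-fromPartner {g = undoubled} x<k (partner-< undoubled-matching x<k)

        Mν : Matching k (partner ν)
        Mν = matching-cong (λ x h → sym (partner-ν x h)) undoubled-matching

        νi≡r : partner ν i ≡ r
        νi≡r = begin
          partner ν i
            ≡⟨ partner-ν i (<-trans i<r r<k) ⟩
          punchOut₂ (suc i) (suc r) (partner v (punchIn₂ (suc i) (suc r) i))
            ≡⟨ cong (punchOut₂ (suc i) (suc r) ∘ partner v) (trans (cong (punchIn (suc r)) (punchIn-< (n<1+n i)))
               (punchIn-< (<-trans i<r (n<1+n r)))) ⟩
          punchOut₂ (suc i) (suc r) (partner v i)
            ≡⟨ cong (punchOut₂ (suc i) (suc r)) (outer o) ⟩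
          punchOut (suc i) (punchOut (suc r) (suc (suc r)))
            ≡⟨ cong (punchOut (suc i)) (punchOut-suc-self (suc r)) ⟩
          punchOut (suc i) (suc r)
            ≡⟨ suc-injective (punchOut-> i+1<r+1) ⟩
          r ∎
          where open ≡-Reasoning

        redoubled≗v : ∀ x → x < K → insertArc (suc i) (suc r) (partner ν) x ≡ partner v x
        redoubled≗v x x<K = trans (insertArc-cong i+1<r+1 partner-ν r+1<k+2 x x<K)
                                  (insertArc-removeArc i+1<r+1 r+1<k+2 Mv (inner o) x x<K)

        ν-avoids : Avoids21 ν
        ν-avoids = avoiding⇒avoids21 ν (Mν , λ i₂ j₂ o₂ →
          let (_ , j′ , o′ , j′≢r+1) = DoubleArc.occurrence-doubled⁺ Mν i<r r<k νi≡r o₂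
          in j′≢r+1 (proj₂ (occurrence-unique-removeLast o (occurrence-cong redoubled≗v o′))))

        doubleV-ν : doubleV ν i r ≡ v
        doubleV-ν = partner-injective _ _ λ x x<K →
          trans (partner-fromPartner x<K (subst (_< K) (sym (redoubled≗v x x<K)) (partner-< Mv x<K)))
                (redoubled≗v x x<K)

        x = chooseEnd p i (suc r)

      decode-∈ : decode w i (suc r) ∈ cartesianProduct (avoiders k) (upTo k)
      decode-∈ =
        ∈-cartesianProduct⁺ (∈-avoiders⁺ ν-avoids) (∈-upTo⁺ (chooseEnd-< p (<-trans i<r r<k) r<k))

      forward-decode : forward (decode w i (suc r)) ≡ w
      forward-decode with occurrence-separated o
      ... | inj₁ p≡i+1 = begin
        forward (ν , x)
          ≡⟨ cong (λ z → forward (ν , z)) (chooseEnd-≡ (suc r) p≡i+1) ⟩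
        forward (ν , i)
          ≡⟨ forward-< ν i (subst (i <_) (sym νi≡r) i<r) ⟩
        insertLast (suc i) (doubleV ν i (partner ν i))
          ≡⟨ cong₂ (λ a b → insertLast a (doubleV ν i b)) (sym p≡i+1) νi≡r ⟩
        insertLast p (doubleV ν i r)
          ≡⟨ cong (insertLast p) doubleV-ν ⟩
        insertLast p v
          ≡⟨ insertLast-removeLast w Mw ⟩
        w ∎
        where open ≡-Reasoning
      ... | inj₂ p≡r+2 = begin
        forward (ν , x)
          ≡⟨ cong (λ z → forward (ν , z)) (chooseEnd-≢ (suc r) p≢i+1) ⟩
        forward (ν , r)
          ≡⟨ forward-≮ ν r (λ r<νr → <-asym i<r (subst (r <_) νr≡i r<νr)) ⟩
        insertLast (suc (suc r)) (doubleV ν (partner ν r) r)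
          ≡⟨ cong₂ (λ a b → insertLast a (doubleV ν b r)) (sym p≡r+2) νr≡i ⟩
        insertLast p (doubleV ν i r)
          ≡⟨ cong (insertLast p) doubleV-ν ⟩
        insertLast p v
          ≡⟨ insertLast-removeLast w Mw ⟩
        w ∎
        where
        open ≡-Reasoning
        νr≡i : partner ν r ≡ i
        νr≡i = trans (cong (partner ν) (sym νi≡r)) (involutive Mν (<-trans i<r r<k))
        p≢i+1 : p ≢ suc i
        p≢i+1 e = <-irrefl (suc-injective (trans (sym e) p≡r+2)) (<-trans i<r (n<1+n r))

  private
    pairs = cartesianProduct (avoiders k) (upTo k)
    creating = filter (λ w → ¬? (avoids21? (removeLast w))) (avoiders (suc (suc K)))

    creating⁻ : ∀ {w} → w ∈ creating → Avoids21 w × ¬ Avoids21 (removeLast w)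
    creating⁻ w∈ =
      let (w∈′ , not-avoids) = ∈-filter⁻ (λ w → ¬? (avoids21? (removeLast w))) {xs = avoiders (suc (suc K))} w∈
      in ∈-avoiders⁻ w∈′ , not-avoids

    module _ (ν : Matchings k) {x : ℕ} (ν-avoids : Avoids21 ν) (x<k : x < k) where
      private
        M = proj₁ (avoids21⇒avoiding ν ν-avoids)
        y = partner ν x
        y<k = partner-< M x<k

        y<x : ¬ x < y → y < x
        y<x x≮y = ≤∧≢⇒< (≮⇒≥ x≮y) (partner-≢ M x<k)

        x≢y+1 : ∀ x≮y → suc (suc x) ≢ suc y
        x≢y+1 x≮y e = <⇒≱ (y<x x≮y) (≤-trans (n≤1+n x) (≤-reflexive (suc-injective e)))

      forward-∈ : forward (ν , x) ∈ creating
      forward-∈ = by-order (x <? y)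
        where
        by-order : Dec (x < y) → forward (ν , x) ∈ creating
        by-order (yes x<y) = subst (_∈ creating) (sym (forward-< ν x x<y)) w-∈
          where open Doubling ν ν-avoids x<y y<k refl (inj₁ refl)
        by-order (no x≮y)  = subst (_∈ creating) (sym (forward-≮ ν x x≮y)) w-∈
          where open Doubling ν ν-avoids (y<x x≮y) x<k (involutive M x<k) (inj₂ refl)

      backward-forward : backward (forward (ν , x)) ≡ (ν , x)
      backward-forward = by-order (x <? y)
        where
        by-order : Dec (x < y) → backward (forward (ν , x)) ≡ (ν , x)
        by-order (yes x<y) = trans (cong backward (forward-< ν x x<y))
                                   (trans backward-w (cong (ν ,_) (chooseEnd-≡ (suc y) refl)))
          where open Doubling ν ν-avoids x<y y<k refl (inj₁ refl)
        by-order (no x≮y)  = trans (cong backward (forward-≮ ν x x≮y))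
                                   (trans backward-w (cong (ν ,_) (chooseEnd-≢ (suc x) (x≢y+1 x≮y))))
          where open Doubling ν ν-avoids (y<x x≮y) x<k (involutive M x<k) (inj₂ refl)

    module _ (w : Matchings (suc (suc K))) (w-avoids : Avoids21 w) (not-avoids : ¬ Avoids21 (removeLast w)) where
      private
        found : Decoding w
        found = backward-decode w not-avoids
                  (matching⇒isMatching (removeLast w)
                    (removeLast-matching w (proj₁ (avoids21⇒avoiding w w-avoids))))

      backward-∈ : backward w ∈ pairs
      backward-∈ = from found
        where
        from : Decoding w → backward w ∈ pairs
        from (_ , zero  , occurrence () _ _ _ , _)
        from (i , suc r , o , backward≡) = subst (_∈ pairs) (sym backward≡) (Undoubling.decode-∈ w w-avoids o)

      forward-backward : forward (backward w) ≡ w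
      forward-backward = from found
        where
        from : Decoding w → forward (backward w) ≡ w
        from (_ , zero  , occurrence () _ _ _ , _)
        from (i , suc r , o , backward≡) = trans (cong forward backward≡) (Undoubling.forward-decode w w-avoids o)

  length-removeLast-not-avoiding :
    length (filter (λ w → ¬? (avoids21? (removeLast w))) (avoiders (suc (suc K)))) ≡ length (avoiders k) * k
  length-removeLast-not-avoiding = begin
    length creating                         ≡⟨ pairs↔creating ⟨
    length pairs                            ≡⟨ length-cartesianProduct (avoiders k) (upTo k) ⟩
    length (avoiders k) * length (upTo k)   ≡⟨ cong (length (avoiders k) *_) (length-upTo k) ⟩
    length (avoiders k) * k                 ∎
    where
    open ≡-Reasoning
    avoids : ∀ {ν x} → (ν , x) ∈ pairs → Avoids21 ν
    avoids νx∈ = ∈-avoiders⁻ (proj₁ (∈-cartesianProduct⁻ (avoiders k) (upTo k) νx∈))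
    bounded : ∀ {ν x} → (ν , x) ∈ pairs → x < k
    bounded νx∈ = ∈-upTo⁻ (proj₂ (∈-cartesianProduct⁻ (avoiders k) (upTo k) νx∈))
    pairs↔creating : length pairs ≡ length creating
    pairs↔creating = length-≡-bijection pairs creating
      (cartesianProduct⁺ (avoiders-unique k) (upTo⁺ k)) (filter⁺ _ (avoiders-unique (suc (suc K))))
      forward backward
      (λ { {ν , x} νx∈ → forward-∈ ν (avoids νx∈) (bounded νx∈) })
      (λ {w} w∈ → backward-∈ w (proj₁ (creating⁻ w∈)) (proj₂ (creating⁻ w∈)))
      (λ { {ν , x} νx∈ → backward-forward ν (avoids νx∈) (bounded νx∈) })
      (λ {w} w∈ → forward-backward w (proj₁ (creating⁻ w∈)) (proj₂ (creating⁻ w∈)))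

avoiders-recurrence : ∀ k →
  length (avoiders (4 + k)) ≡ length (avoiders (2 + k)) * (2 + k) + length (avoiders k) * k
avoiders-recurrence k =
  trans (length-filter-split (λ w → avoids21? (removeLast w)) (avoiders (4 + k)))
        (cong₂ _+_ (length-removeLast-avoiding (suc k)) (length-removeLast-not-avoiding k))

a0-recurrence : (n : ℕ) → 2 ≤ n → a0 (suc n) ≡ 2 * n * a0 n + 2 * (n ∸ 1) * a0 (n ∸ 1)
a0-recurrence (suc zero) (s≤s ())
a0-recurrence (suc (suc m)) _ = begin
  a0 (3 + m)
    ≡⟨ a0≡length-avoiders (3 + m) ⟩
  length (avoiders (2 * (3 + m)))
    ≡⟨ cong (length ∘ avoiders) 2[3+m]≡4+k ⟩
  length (avoiders (4 + k))
    ≡⟨ avoiders-recurrence k ⟩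
  length (avoiders (2 + k)) * (2 + k) + length (avoiders k) * k
    ≡⟨ cong₂ _+_ (*-comm (length (avoiders (2 + k))) (2 + k)) (*-comm (length (avoiders k)) k) ⟩
  (2 + k) * length (avoiders (2 + k)) + k * length (avoiders k)
    ≡⟨ cong (λ n → n * length (avoiders n) + k * length (avoiders k)) 2[2+m]≡2+k ⟨
  2 * (2 + m) * length (avoiders (2 * (2 + m))) + k * length (avoiders k)
    ≡⟨ cong₂ (λ a b → 2 * (2 + m) * a + k * b)
             (a0≡length-avoiders (2 + m)) (a0≡length-avoiders (suc m)) ⟨
  2 * (2 + m) * a0 (2 + m) + k * a0 (suc m) ∎
  where
  open ≡-Reasoning
  k = 2 * suc m
  2[2+m]≡2+k : 2 * (2 + m) ≡ 2 + k
  2[2+m]≡2+k = *-suc 2 (suc m)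
  2[3+m]≡4+k : 2 * (3 + m) ≡ 4 + k
  2[3+m]≡4+k = trans (*-suc 2 (2 + m)) (cong (2 +_) 2[2+m]≡2+k)

corollary2 : (a0 1 ≡ 1) × (a0 2 ≡ 2) ×
    ((n : ℕ) → 2 ≤ n → a0 (suc n) ≡ 2 * n * a0 n + 2 * (n ∸ 1) * a0 (n ∸ 1))
corollary2 = refl , refl , a0-recurrence
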